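{- Let $M=(E,\mathcal I)$ be a loopless matroid with $0<r(E)<|E|$, and let $M^*$ be its dual matroid. Let $\eta^*$ be the optimal density for $\mathrm{Mod}_2(\widehat{\mathcal B(M)})$ and $\eta^*_\circ$ the optimal density for $\mathrm{Mod}_2(\widehat{\mathcal B(M^*)})$. Then $\eta^*+\eta^*_\circ=\mathbf 1$. Moreover, if $M^*$ is loopless, then $\frac1{D(M)}+\frac1{S(M^*)}=1$ and $\frac1{S(M)}+\frac1{D(M^*)}=1$.
   Context: $\mathcal B(N)$ is the base family of a matroid $N$, bases identified with indicator vectors; the dual matroid $M^*$ on $E$ has bases $\{E\setminus B:B\in\mathcal B(M)\}$. For $\Gamma\subseteq\mathbb R^E_{\ge0}$, $\mathrm{Adm}(\Gamma)=\{\rho\in\mathbb R^E_{\ge0}:\sum_e\gamma(e)\rho(e)\ge1\ \forall\gamma\in\Gamma\}$; $\widehat\Gamma$ (Fulkerson blocker family) is the set of extreme points of $\mathrm{Adm}(\Gamma)$; $\mathrm{Mod}_2(\Gamma)=\min\{\sum_e\rho(e)^2:\rho\in\mathrm{Adm}(\Gamma)\}$ with unique minimizer (optimal density). For a matroid $N$ on $E$ with rank function $r_N$: strength $S(N)=\min\{|X|/(r_N(E)-r_N(E\setminus X)):X\subseteq E,\ r_N(E)>r_N(E\setminus X)\}$; fractional arboricity $D(N)=\max\{|X|/r_N(X):X\subseteq E,\ r_N(X)>0\}$. $\mathbf 1$ is the all-ones vector.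
   Formalization: The admissible densities, the extreme points forming the blocker families and the optimal densities $\eta^*$ and $\eta^*_\circ$ have rational entries rather than real ones. -}

module Defs where

open import Level using (0ℓ)
open import Data.Nat as ℕ using (ℕ; zero; suc)
open import Data.Integer using (+_)
open import Data.Rational as ℚ using (ℚ; 0ℚ; 1ℚ; _+_; _*_; _-_; _≤_; _<_; _/_; 1/_; _≟_; ≢-nonZero)
open import Data.Fin using (Fin)
open import Data.Fin.Subset using (Subset; _∈_; _∉_; _⊆_; _∩_; _∪_; ∁; ⁅_⁆; ∣_∣; ⊤; inside; outside)
open import Data.Vec using (lookup)
import Data.Fin.Subset as Sub
open import Data.Bool using (true; false)
open import Data.Product using (Σ; ∃; _×_; _,_)
open import Relation.Nullary using (yes; no)
open import Relation.Binary.PropositionalEquality using (_≡_)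

record Matroid (n : ℕ) : Set₁ where
  field
    IsBase      : Subset n → Set
    base-exists : ∃ λ B → IsBase B
    exchange    : ∀ B₁ B₂ → IsBase B₁ → IsBase B₂ → ∀ x → x ∈ B₁ → x ∉ B₂ →
                  ∃ λ y → y ∈ B₂ × y ∉ B₁ × IsBase ((B₁ Sub.- x) ∪ ⁅ y ⁆)
open Matroid public

BaseFamily : ℕ → Set₁
BaseFamily n = Subset n → Set

dualBases : ∀ {n} → BaseFamily n → BaseFamily n
dualBases 𝓑 X = 𝓑 (∁ X)

Indep : ∀ {n} → BaseFamily n → Subset n → Set
Indep 𝓑 X = ∃ λ B → 𝓑 B × X ⊆ B

Loopless : ∀ {n} → BaseFamily n → Set
Loopless {n} 𝓑 = (e : Fin n) → Indep 𝓑 ⁅ e ⁆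

-- r(X) = k  :  the rank of X is k (max size of an independent subset of X,
-- i.e. max |B ∩ X| over bases B).
RankIs : ∀ {n} → BaseFamily n → Subset n → ℕ → Set
RankIs 𝓑 X k = (∃ λ B → 𝓑 B × ∣ B ∩ X ∣ ≡ k)
             × (∀ B → 𝓑 B → ∣ B ∩ X ∣ ℕ.≤ k)

-- a ÷ b as a rational (only used with b > 0; value 0 for b = 0).
_÷ℕ_ : ℕ → ℕ → ℚ
a ÷ℕ zero  = 0ℚ
a ÷ℕ suc b = (+ a) / suc b

-- multiplicative inverse (only used on non-zero arguments; 0⁻¹ := 0).
recip : ℚ → ℚ
recip q with q ≟ 0ℚ
... | yes _  = 0ℚ
... | no q≢0 = 1/_ q {{≢-nonZero q≢0}}

IsStrength : ∀ {n} → BaseFamily n → ℚ → Set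
IsStrength 𝓑 s =
    (∃ λ X → ∃ λ k₁ → ∃ λ k₂ → RankIs 𝓑 ⊤ k₁ × RankIs 𝓑 (∁ X) k₂ × k₂ ℕ.< k₁
       × s ≡ ∣ X ∣ ÷ℕ (k₁ ℕ.∸ k₂))
  × (∀ X k₁ k₂ → RankIs 𝓑 ⊤ k₁ → RankIs 𝓑 (∁ X) k₂ → k₂ ℕ.< k₁
       → s ≤ ∣ X ∣ ÷ℕ (k₁ ℕ.∸ k₂))

IsFracArboricity : ∀ {n} → BaseFamily n → ℚ → Set
IsFracArboricity 𝓑 d =
    (∃ λ X → ∃ λ k → RankIs 𝓑 X k × 0 ℕ.< k × d ≡ ∣ X ∣ ÷ℕ k)
  × (∀ X k → RankIs 𝓑 X k → 0 ℕ.< k → ∣ X ∣ ÷ℕ k ≤ d)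

Vect : ℕ → Set
Vect n = Fin n → ℚ

Σ[_] : ∀ {n} → Vect n → ℚ
Σ[_] {zero}  f = 0ℚ
Σ[_] {suc n} f = f Fin.zero + Σ[_] {n} (λ i → f (Fin.suc i))
  where import Data.Fin as Fin

dot : ∀ {n} → Vect n → Vect n → ℚ
dot γ ρ = Σ[ (λ e → γ e * ρ e) ]

energy : ∀ {n} → Vect n → ℚ
energy ρ = Σ[ (λ e → ρ e * ρ e) ]

Family : ℕ → Set₁
Family n = Vect n → Set

indicator : ∀ {n} → Subset n → Vect n
indicator X e with lookup X e
... | true  = 1ℚ
... | false = 0ℚ

baseVecs : ∀ {n} → BaseFamily n → Family n
baseVecs 𝓑 γ = ∃ λ B → 𝓑 B × (∀ e → γ e ≡ indicator B e)

Adm : ∀ {n} → Family n → Family n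
Adm Γ ρ = (∀ e → 0ℚ ≤ ρ e) × (∀ γ → Γ γ → 1ℚ ≤ dot γ ρ)

Extreme : ∀ {n} → Family n → Family n
Extreme P x = P x ×
  (∀ y z t → P y → P z → 0ℚ < t → t < 1ℚ →
     (∀ e → x e ≡ t * y e + (1ℚ - t) * z e) → ∀ e → y e ≡ z e)

blocker : ∀ {n} → Family n → Family n
blocker Γ = Extreme (Adm Γ)

OptimalDensity : ∀ {n} → Family n → Vect n → Set
OptimalDensity Γ ρ = Adm Γ ρ × (∀ ρ′ → Adm Γ ρ′ → energy ρ ≤ energy ρ′)

module Submission where

-- The optimal density η of Mod₂ of the blocker of 𝓑(M) lies in the base polytope. Indeed
-- η · v ≥ 1 on the extreme points v of Adm(𝓑(M)), hence on all of Adm(𝓑(M)); by Farkas'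
-- lemma (Fourier–Motzkin elimination) η then dominates a convex combination of bases, and
-- minimality of the energy forces equality. Complementation maps the base polytope of M
-- onto that of M*, and since all its points have total mass r(E) it shifts energies by a
-- constant; so 1 - η is optimal for M*, and equals η∘ by uniqueness of the optimum.
-- The second part is rank duality, r*(E ∖ X) = |E ∖ X| - r(E) + r(X): the strength
-- denominator of M* at X is the nullity |X| - r(X) in M, so
-- 1/S(M*) = max (1 - r(X)/|X|) = 1 - 1/D(M), and symmetrically with M and M* exchanged.

module RationalFacts where

  open import Data.Rational
  open import Data.Rational.Properties
  open import Data.Rational.Solver
  open import Relation.Binary.PropositionalEquality
  open import Relation.Nullary using (¬_; yes; no)
  open import Relation.Binary.Definitions using (tri<; tri≈; tri>)
  open import Data.Sum using (inj₁; inj₂)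
  open import Data.Empty using (⊥-elim)
  open import Defs using (recip)
  open +-*-Solver

  p+[q-p]≡q : ∀ p q → p + (q - p) ≡ q
  p+[q-p]≡q = solve 2 (λ p q → p :+ (q :- p) := q) refl

  p≤q⇒0≤q-p : ∀ {p q} → p ≤ q → 0ℚ ≤ q - p
  p≤q⇒0≤q-p {p} {q} p≤q =
    subst (_≤ q - p) (+-inverseʳ p) (+-monoˡ-≤ (- p) p≤q)

  0≤q-p⇒p≤q : ∀ {p q} → 0ℚ ≤ q - p → p ≤ q
  0≤q-p⇒p≤q {p} {q} 0≤q-p =
    subst₂ _≤_ (+-identityʳ p) (p+[q-p]≡q p q)
      (+-monoʳ-≤ p 0≤q-p)

  p<q⇒0<q-p : ∀ {p q} → p < q → 0ℚ < q - p
  p<q⇒0<q-p {p} {q} p<q =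
    subst (_< q - p) (+-inverseʳ p) (+-monoˡ-< (- p) p<q)

  0<q-p⇒p<q : ∀ {p q} → 0ℚ < q - p → p < q
  0<q-p⇒p<q {p} {q} 0<q-p =
    subst₂ _<_ (+-identityʳ p) (p+[q-p]≡q p q)
      (+-monoʳ-< p 0<q-p)

  ≤-by-difference : ∀ {p q p′ q′} → p ≤ q → q - p ≡ q′ - p′ → p′ ≤ q′
  ≤-by-difference p≤q eq = 0≤q-p⇒p≤q (subst (0ℚ ≤_) eq (p≤q⇒0≤q-p p≤q))

  ≤∧≢⇒< : ∀ {p q} → p ≤ q → ¬ p ≡ q → p < q
  ≤∧≢⇒< {p} {q} p≤q p≢q with <-cmp p q
  ... | tri< p<q _ _ = p<q
  ... | tri≈ _ p≡q _ = ⊥-elim (p≢q p≡q)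
  ... | tri> _ _ p>q = ⊥-elim (<-irrefl refl (<-≤-trans p>q p≤q))

  0≤1 : 0ℚ ≤ 1ℚ
  0≤1 = <⇒≤ (positive⁻¹ 1ℚ)

  +-nonNeg : ∀ {p q} → 0ℚ ≤ p → 0ℚ ≤ q → 0ℚ ≤ p + q
  +-nonNeg = +-mono-≤

  *-nonNeg : ∀ {p q} → 0ℚ ≤ p → 0ℚ ≤ q → 0ℚ ≤ p * q
  *-nonNeg {p} {q} 0≤p 0≤q = nonNegative⁻¹ (p * q)
    {{nonNeg*nonNeg⇒nonNeg p {{nonNegative 0≤p}} q {{nonNegative 0≤q}}}}

  *-pos : ∀ {p q} → 0ℚ < p → 0ℚ < q → 0ℚ < p * q
  *-pos {p} {q} 0<p 0<q = positive⁻¹ (p * q)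
    {{pos*pos⇒pos p {{positive 0<p}} q {{positive 0<q}}}}

  *-monoˡ-≤-0≤ : ∀ {p q} r → 0ℚ ≤ r → p ≤ q → r * p ≤ r * q
  *-monoˡ-≤-0≤ r 0≤r = *-monoˡ-≤-nonNeg r {{nonNegative 0≤r}}

  *-monoʳ-≤-0≤ : ∀ {p q} r → 0ℚ ≤ r → p ≤ q → p * r ≤ q * r
  *-monoʳ-≤-0≤ r 0≤r = *-monoʳ-≤-nonNeg r {{nonNegative 0≤r}}

  0≤p*p : ∀ p → 0ℚ ≤ p * p
  0≤p*p p with ≤-total 0ℚ p
  ... | inj₁ 0≤p = *-nonNeg 0≤p 0≤p
  ... | inj₂ p≤0 = nonNegative⁻¹ (p * p)
    {{nonPos*nonPos⇒nonPos p {{nonPositive p≤0}} p {{nonPositive p≤0}}}}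

  p*p≤0⇒p≡0 : ∀ p → p * p ≤ 0ℚ → p ≡ 0ℚ
  p*p≤0⇒p≡0 p p*p≤0 with <-cmp p 0ℚ
  ... | tri≈ _ p≡0 _ = p≡0
  ... | tri> _ _ p>0 = ⊥-elim (<-irrefl refl (<-≤-trans (*-pos p>0 p>0) p*p≤0))
  ... | tri< p<0 _ _ = ⊥-elim (<-irrefl refl (<-≤-trans 0<p*p p*p≤0))
    where
    0<p*p : 0ℚ < p * p
    0<p*p = positive⁻¹ (p * p) {{neg*neg⇒pos p {{negative p<0}} p {{negative p<0}}}}

  nonNeg+nonNeg≡0⇒ˡ≡0 : ∀ {p q} → 0ℚ ≤ p → 0ℚ ≤ q → p + q ≡ 0ℚ → p ≡ 0ℚ
  nonNeg+nonNeg≡0⇒ˡ≡0 {p} {q} 0≤p 0≤q p+q≡0 = ≤-antisym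
    (subst₂ _≤_ (+-identityʳ p) p+q≡0 (+-monoʳ-≤ p 0≤q)) 0≤p

  pos⇒≢0 : ∀ {p} → 0ℚ < p → ¬ p ≡ 0ℚ
  pos⇒≢0 0<p refl = <-irrefl refl 0<p

  *-recipʳ : ∀ p → ¬ p ≡ 0ℚ → p * recip p ≡ 1ℚ
  *-recipʳ p p≢0 with p ≟ 0ℚ
  ... | yes p≡0 = ⊥-elim (p≢0 p≡0)
  ... | no p≢0′ = *-inverseʳ p {{≢-nonZero p≢0′}}

  *-recipˡ : ∀ p → ¬ p ≡ 0ℚ → recip p * p ≡ 1ℚ
  *-recipˡ p p≢0 = trans (*-comm (recip p) p) (*-recipʳ p p≢0)

  recip-unique : ∀ p q → p * q ≡ 1ℚ → recip p ≡ q
  recip-unique p q pq≡1 = begin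
    recip p             ≡⟨ *-identityʳ (recip p) ⟨
    recip p * 1ℚ        ≡⟨ cong (recip p *_) pq≡1 ⟨
    recip p * (p * q)   ≡⟨ *-assoc (recip p) p q ⟨
    recip p * p * q     ≡⟨ cong (_* q) (*-recipˡ p p≢0) ⟩
    1ℚ * q              ≡⟨ *-identityˡ q ⟩
    q                   ∎
    where
    open ≡-Reasoning
    p≢0 : ¬ p ≡ 0ℚ
    p≢0 refl = 1≢0 (trans (sym pq≡1) (*-zeroˡ q))

  recip-pos : ∀ {p} → 0ℚ < p → 0ℚ < recip p
  recip-pos {p} 0<p with p ≟ 0ℚ
  ... | yes p≡0 = ⊥-elim (pos⇒≢0 0<p p≡0)
  ... | no _ = positive⁻¹ _ {{1/pos⇒pos p {{positive 0<p}}}}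

  pos*≡0⇒≡0 : ∀ {p q} → 0ℚ < p → p * q ≡ 0ℚ → q ≡ 0ℚ
  pos*≡0⇒≡0 {p} {q} 0<p pq≡0 = begin
    q                   ≡⟨ *-identityˡ q ⟨
    1ℚ * q              ≡⟨ cong (_* q) (*-recipˡ p (pos⇒≢0 0<p)) ⟨
    recip p * p * q     ≡⟨ *-assoc (recip p) p q ⟩
    recip p * (p * q)   ≡⟨ cong (recip p *_) pq≡0 ⟩
    recip p * 0ℚ        ≡⟨ *-zeroʳ (recip p) ⟩
    0ℚ                  ∎
    where open ≡-Reasoning

  -p≤0⇒0≤p : ∀ {p} → - p ≤ 0ℚ → 0ℚ ≤ p
  -p≤0⇒0≤p {p} -p≤0 = ≤-by-difference -p≤0 (solve 1 (λ p → con 0ℚ :- (:- p) := p :- con 0ℚ) refl p)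

  p-q≡0⇒p≡q : ∀ {p q} → p - q ≡ 0ℚ → p ≡ q
  p-q≡0⇒p≡q {p} {q} p-q≡0 = begin
    p             ≡⟨ solve 2 (λ p q → p := (p :- q) :+ q) refl p q ⟩
    (p - q) + q   ≡⟨ cong (_+ q) p-q≡0 ⟩
    0ℚ + q        ≡⟨ +-identityˡ q ⟩
    q             ∎
    where open ≡-Reasoning

module FiniteSums where

  open import Defs using (Vect; Σ[_]; dot)
  open RationalFacts
  open import Data.Nat using (ℕ; zero; suc)
  open import Data.Fin using (Fin; zero; suc; _≟_)
  open import Data.Rational hiding (_≟_)
  open import Data.Rational.Properties hiding (_≟_)
  open import Data.Rational.Solver
  open import Relation.Binary.PropositionalEquality
  open import Relation.Nullary using (yes; no)
  open +-*-Solver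

  private
    variable
      m n : ℕ

  Σ-cong : {f g : Vect n} → (∀ e → f e ≡ g e) → Σ[ f ] ≡ Σ[ g ]
  Σ-cong {zero}  f≗g = refl
  Σ-cong {suc n} f≗g = cong₂ _+_ (f≗g zero) (Σ-cong (λ e → f≗g (suc e)))

  Σ-0 : Σ[_] {n} (λ _ → 0ℚ) ≡ 0ℚ
  Σ-0 {zero}  = refl
  Σ-0 {suc n} = trans (+-identityˡ _) (Σ-0 {n})

  Σ-+ : (f g : Vect n) → Σ[ (λ e → f e + g e) ] ≡ Σ[ f ] + Σ[ g ]
  Σ-+ {zero}  f g = refl
  Σ-+ {suc n} f g = trans
    (cong (f zero + g zero +_) (Σ-+ (λ e → f (suc e)) (λ e → g (suc e))))
    (solve 4 (λ a b c d → (a :+ b) :+ (c :+ d) := (a :+ c) :+ (b :+ d)) refl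
       (f zero) (g zero) Σ[ (λ e → f (suc e)) ] Σ[ (λ e → g (suc e)) ])

  Σ-* : (c : ℚ) (f : Vect n) → Σ[ (λ e → c * f e) ] ≡ c * Σ[ f ]
  Σ-* {zero}  c f = sym (*-zeroʳ c)
  Σ-* {suc n} c f = trans (cong (c * f zero +_) (Σ-* c (λ e → f (suc e))))
    (sym (*-distribˡ-+ c (f zero) Σ[ (λ e → f (suc e)) ]))

  Σ-neg : (f : Vect n) → Σ[ (λ e → - f e) ] ≡ - Σ[ f ]
  Σ-neg {zero}  f = refl
  Σ-neg {suc n} f = trans (cong (- f zero +_) (Σ-neg (λ e → f (suc e))))
    (sym (neg-distrib-+ (f zero) Σ[ (λ e → f (suc e)) ]))

  Σ-sub : (f g : Vect n) → Σ[ (λ e → f e - g e) ] ≡ Σ[ f ] - Σ[ g ]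
  Σ-sub f g = trans (Σ-+ f (λ e → - g e)) (cong (Σ[ f ] +_) (Σ-neg g))

  Σ-mono-≤ : {f g : Vect n} → (∀ e → f e ≤ g e) → Σ[ f ] ≤ Σ[ g ]
  Σ-mono-≤ {zero}  f≤g = ≤-refl
  Σ-mono-≤ {suc n} f≤g = +-mono-≤ (f≤g zero) (Σ-mono-≤ (λ e → f≤g (suc e)))

  Σ-nonNeg : {f : Vect n} → (∀ e → 0ℚ ≤ f e) → 0ℚ ≤ Σ[ f ]
  Σ-nonNeg {n} {f} 0≤f = subst (_≤ Σ[ f ]) (Σ-0 {n}) (Σ-mono-≤ 0≤f)

  Σ-nonNeg≤0⇒≡0 : {f : Vect n} → (∀ e → 0ℚ ≤ f e) → Σ[ f ] ≤ 0ℚ → ∀ e → f e ≡ 0ℚ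
  Σ-nonNeg≤0⇒≡0 {suc n} {f} 0≤f Σf≤0 = λ
    { zero    → nonNeg+nonNeg≡0⇒ˡ≡0 (0≤f zero) 0≤tail Σf≡0
    ; (suc e) → Σ-nonNeg≤0⇒≡0 (λ e → 0≤f (suc e)) (≤-reflexive tail≡0) e
    }
    where
    0≤tail : 0ℚ ≤ Σ[ (λ e → f (suc e)) ]
    0≤tail = Σ-nonNeg (λ e → 0≤f (suc e))
    Σf≡0 : Σ[ f ] ≡ 0ℚ
    Σf≡0 = ≤-antisym Σf≤0 (Σ-nonNeg 0≤f)
    tail≡0 : Σ[ (λ e → f (suc e)) ] ≡ 0ℚ
    tail≡0 = nonNeg+nonNeg≡0⇒ˡ≡0 0≤tail (0≤f zero) (trans (+-comm _ (f zero)) Σf≡0)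

  Σ-swap : (f : Fin m → Fin n → ℚ) →
           Σ[ (λ i → Σ[ (λ j → f i j) ]) ] ≡ Σ[ (λ j → Σ[ (λ i → f i j) ]) ]
  Σ-swap {zero}  {n} f = sym (Σ-0 {n})
  Σ-swap {suc m} {n} f = trans
    (cong (Σ[ (λ j → f zero j) ] +_) (Σ-swap (λ i j → f (suc i) j)))
    (sym (Σ-+ (λ j → f zero j) (λ j → Σ[ (λ i → f (suc i) j) ])))

  unit : Fin n → Vect n
  unit e i with e ≟ i
  ... | yes _ = 1ℚ
  ... | no _  = 0ℚ

  unit-nonNeg : (e i : Fin n) → 0ℚ ≤ unit e i
  unit-nonNeg e i with e ≟ i
  ... | yes _ = 0≤1
  ... | no _  = ≤-refl

  dot-unitˡ : (e : Fin n) (x : Vect n) → dot (unit e) x ≡ x e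
  dot-unitˡ {suc n} zero x = begin
    1ℚ * x zero + Σ[ (λ i → 0ℚ * x (suc i)) ] ≡⟨ cong₂ _+_ (*-identityˡ (x zero))
                                                   (trans (Σ-cong (λ i → *-zeroˡ (x (suc i)))) (Σ-0 {n})) ⟩
    x zero + 0ℚ                               ≡⟨ +-identityʳ (x zero) ⟩
    x zero                                    ∎
    where open ≡-Reasoning
  dot-unitˡ {suc n} (suc e) x = trans
    (cong₂ _+_ (*-zeroˡ (x zero)) (trans (Σ-cong unit-suc) (dot-unitˡ e (λ i → x (suc i)))))
    (+-identityˡ (x (suc e)))
    where
    unit-suc : ∀ i → unit (suc e) (suc i) * x (suc i) ≡ unit e i * x (suc i)
    unit-suc i with e ≟ i
    ... | yes _ = refl
    ... | no _  = refl

  dot-comm : (a b : Vect n) → dot a b ≡ dot b a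
  dot-comm a b = Σ-cong (λ e → *-comm (a e) (b e))

  dot-cong : {a a′ b b′ : Vect n} → (∀ e → a e ≡ a′ e) → (∀ e → b e ≡ b′ e) → dot a b ≡ dot a′ b′
  dot-cong a≗a′ b≗b′ = Σ-cong (λ e → cong₂ _*_ (a≗a′ e) (b≗b′ e))

  dot-0ˡ : (x : Vect n) → dot (λ _ → 0ℚ) x ≡ 0ℚ
  dot-0ˡ {n} x = trans (Σ-cong (λ e → *-zeroˡ (x e))) (Σ-0 {n})

  dot-0ʳ : (a : Vect n) → dot a (λ _ → 0ℚ) ≡ 0ℚ
  dot-0ʳ a = trans (dot-comm a _) (dot-0ˡ a)

  dot-+ˡ : (a b x : Vect n) → dot (λ e → a e + b e) x ≡ dot a x + dot b x
  dot-+ˡ a b x = trans (Σ-cong (λ e → *-distribʳ-+ (x e) (a e) (b e)))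
    (Σ-+ (λ e → a e * x e) (λ e → b e * x e))

  dot-+ʳ : (a x y : Vect n) → dot a (λ e → x e + y e) ≡ dot a x + dot a y
  dot-+ʳ a x y = trans (dot-comm a _) (trans (dot-+ˡ x y a) (cong₂ _+_ (dot-comm x a) (dot-comm y a)))

  dot-*ˡ : (c : ℚ) (a x : Vect n) → dot (λ e → c * a e) x ≡ c * dot a x
  dot-*ˡ c a x = trans (Σ-cong (λ e → *-assoc c (a e) (x e))) (Σ-* c (λ e → a e * x e))

  dot-*ʳ : (c : ℚ) (a x : Vect n) → dot a (λ e → c * x e) ≡ c * dot a x
  dot-*ʳ c a x = trans (dot-comm a _) (trans (dot-*ˡ c x a) (cong (c *_) (dot-comm x a)))

  dot-negˡ : (a x : Vect n) → dot (λ e → - a e) x ≡ - dot a x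
  dot-negˡ a x = trans (Σ-cong (λ e → sym (neg-distribˡ-* (a e) (x e)))) (Σ-neg (λ e → a e * x e))

  dot-negʳ : (a x : Vect n) → dot a (λ e → - x e) ≡ - dot a x
  dot-negʳ a x = trans (dot-comm a _) (trans (dot-negˡ x a) (cong -_ (dot-comm x a)))

  dot-subˡ : (a b x : Vect n) → dot (λ e → a e - b e) x ≡ dot a x - dot b x
  dot-subˡ a b x = trans (dot-+ˡ a (λ e → - b e) x) (cong (dot a x +_) (dot-negˡ b x))

  dot-sub-scaledˡ : (a d x : Vect n) (s : ℚ) → dot (λ e → a e - s * d e) x ≡ dot a x - s * dot d x
  dot-sub-scaledˡ a d x s = trans (dot-subˡ a (λ e → s * d e) x) (cong (λ u → dot a x - u) (dot-*ˡ s d x))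

  dot-sub-scaledʳ : (a x d : Vect n) (s : ℚ) → dot a (λ e → x e - s * d e) ≡ dot a x - s * dot a d
  dot-sub-scaledʳ a x d s = trans (dot-comm a _) (trans (dot-sub-scaledˡ x d a s)
    (cong₂ (λ u v → u - s * v) (dot-comm x a) (dot-comm d a)))

  dot-nonNeg : {a x : Vect n} → (∀ e → 0ℚ ≤ a e) → (∀ e → 0ℚ ≤ x e) → 0ℚ ≤ dot a x
  dot-nonNeg 0≤a 0≤x = Σ-nonNeg (λ e → *-nonNeg (0≤a e) (0≤x e))

  dot-combination : (w : Vect n) (μ : Fin m → ℚ) (v : Fin m → Vect n) →
    dot w (λ e → Σ[ (λ i → μ i * v i e) ]) ≡ Σ[ (λ i → μ i * dot (v i) w) ]
  dot-combination w μ v = begin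
    Σ[ (λ e → w e * Σ[ (λ i → μ i * v i e) ]) ]    ≡⟨ Σ-cong (λ e → Σ-* (w e) (λ i → μ i * v i e)) ⟨
    Σ[ (λ e → Σ[ (λ i → w e * (μ i * v i e)) ]) ]  ≡⟨ Σ-swap (λ e i → w e * (μ i * v i e)) ⟩
    Σ[ (λ i → Σ[ (λ e → w e * (μ i * v i e)) ]) ]  ≡⟨ Σ-cong (λ i → trans (Σ-cong (λ e → rearrange (w e) (μ i) (v i e)))
                                                                          (Σ-* (μ i) (λ e → v i e * w e))) ⟩
    Σ[ (λ i → μ i * dot (v i) w) ]                 ∎
    where
    open ≡-Reasoning
    rearrange : ∀ w μ v → w * (μ * v) ≡ μ * (v * w)
    rearrange = solve 3 (λ w μ v → w :* (μ :* v) := μ :* (v :* w)) refl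

module ListFacts where

  open import Data.Nat as ℕ using (ℕ; suc; z≤n; s≤s)
  open import Data.Nat.Properties as ℕ using (m≤n⇒m≤1+n)
  open import Data.Rational using (ℚ; 0ℚ; _≤_)
  open import Data.Rational.Properties using (≤-decTotalOrder)
  open import Data.List using (List; []; _∷_)
  open import Data.List.Membership.Propositional using (_∈_)
  open import Data.List.Relation.Unary.Any using (here; there)
  import Data.List.Relation.Unary.All as All
  open import Data.Product using (Σ; _×_; _,_)
  open import Data.Empty using (⊥-elim)
  open import Level using (0ℓ)
  open import Relation.Binary.Bundles using (DecTotalOrder)
  open import Relation.Binary.PropositionalEquality using (refl)
  open import Relation.Nullary using (¬_; yes; no)
  open import Relation.Unary using (Pred; Decidable)
  import Data.List.Extrema

  open Data.List.Extrema (DecTotalOrder.totalOrder ≤-decTotalOrder)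

  module _ {A : Set} (f : A → ℚ) where

    minimiser : (x : A) (xs : List A) →
                Σ A λ a → a ∈ x ∷ xs × (∀ {y} → y ∈ x ∷ xs → f a ≤ f y)
    minimiser x xs = argmin f x xs , argmin-all f (here refl) (All.tabulate there) , minimal
      where
      minimal : ∀ {y} → y ∈ x ∷ xs → f (argmin f x xs) ≤ f y
      minimal (here refl) = f[argmin]≤f[⊤] {f = f} x xs
      minimal (there y∈xs) = All.lookup (f[argmin]≤f[xs] {f = f} x xs) y∈xs

    maximiser : (x : A) (xs : List A) →
                Σ A λ a → a ∈ x ∷ xs × (∀ {y} → y ∈ x ∷ xs → f y ≤ f a)
    maximiser x xs = argmax f x xs , argmax-all f (here refl) (All.tabulate there) , maximal
      where
      maximal : ∀ {y} → y ∈ x ∷ xs → f y ≤ f (argmax f x xs)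
      maximal (here refl) = f[⊥]≤f[argmax] {f = f} x xs
      maximal (there y∈xs) = All.lookup (f[xs]≤f[argmax] {f = f} x xs) y∈xs

  module _ {A : Set} {P : Pred A 0ℓ} where

    count : Decidable P → List A → ℕ
    count P? [] = 0
    count P? (x ∷ xs) with P? x
    ... | yes _ = suc (count P? xs)
    ... | no _  = count P? xs

  module _ {A : Set} {P Q : Pred A 0ℓ} (P? : Decidable P) (Q? : Decidable Q) where

    count-mono : ∀ xs → (∀ {x} → x ∈ xs → P x → Q x) → count P? xs ℕ.≤ count Q? xs
    count-mono [] P⇒Q = z≤n
    count-mono (x ∷ xs) P⇒Q with P? x | Q? x
    ... | yes _  | yes _  = s≤s (count-mono xs (λ x∈ → P⇒Q (there x∈)))
    ... | yes px | no ¬qx = ⊥-elim (¬qx (P⇒Q (here refl) px))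
    ... | no _   | yes _  = m≤n⇒m≤1+n (count-mono xs (λ x∈ → P⇒Q (there x∈)))
    ... | no _   | no _   = count-mono xs (λ x∈ → P⇒Q (there x∈))

    count-mono-< : ∀ xs → (∀ {x} → x ∈ xs → P x → Q x) →
                   ∀ {y} → y ∈ xs → Q y → ¬ P y → count P? xs ℕ.< count Q? xs
    count-mono-< (x ∷ xs) P⇒Q y∈ qy ¬py with P? x | Q? x
    count-mono-< (x ∷ xs) P⇒Q (here refl) qy ¬py | yes px | _ = ⊥-elim (¬py px)
    count-mono-< (x ∷ xs) P⇒Q (there y∈) qy ¬py | yes _ | yes _ =
      s≤s (count-mono-< xs (λ x∈ → P⇒Q (there x∈)) y∈ qy ¬py)
    count-mono-< (x ∷ xs) P⇒Q y∈ qy ¬py | yes px | no ¬qx = ⊥-elim (¬qx (P⇒Q (here refl) px))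
    count-mono-< (x ∷ xs) P⇒Q y∈ qy ¬py | no _ | yes _ = s≤s (count-mono xs (λ x∈ → P⇒Q (there x∈)))
    count-mono-< (x ∷ xs) P⇒Q (here refl) qy ¬py | no _ | no ¬qx = ⊥-elim (¬qx qy)
    count-mono-< (x ∷ xs) P⇒Q (there y∈) qy ¬py | no _ | no _ =
      count-mono-< xs (λ x∈ → P⇒Q (there x∈)) y∈ qy ¬py

  module _ {A B : Set} (lo : A → ℚ) (hi : B → ℚ) where

    separating-point : (as : List A) (bs : List B) → (∀ {a b} → a ∈ as → b ∈ bs → lo a ≤ hi b) →
                       Σ ℚ λ x → (∀ {a} → a ∈ as → lo a ≤ x) × (∀ {b} → b ∈ bs → x ≤ hi b)
    separating-point []       []       _     = 0ℚ , (λ ()) , (λ ())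
    separating-point []       (b ∷ bs) _     with minimiser hi b bs
    ... | b′ , _ , b′≤bs = hi b′ , (λ ()) , b′≤bs
    separating-point (a ∷ as) bs       lo≤hi with maximiser lo a as
    ... | a′ , a′∈as , as≤a′ = lo a′ , as≤a′ , lo≤hi a′∈as

module FourierMotzkin where

  open import Defs using (Vect; dot; recip)
  open RationalFacts
  open FiniteSums
  open ListFacts using (separating-point)
  open import Data.Nat using (ℕ; zero; suc)
  open import Data.Fin using (zero; suc)
  open import Data.Vec.Functional using (_∷_; tail)
  open import Data.Rational hiding (_/_)
  open import Data.Rational.Properties
  open import Data.Rational.Solver
  open import Data.List as List using (List; _++_; cartesianProductWith)
  open import Data.List.Membership.Propositional using (_∈_; find)
  open import Data.List.Membership.Propositional.Properties
    using (∈-++⁺ˡ; ∈-++⁺ʳ; ∈-++⁻; ∈-cartesianProductWith⁺; ∈-cartesianProductWith⁻)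
  open import Data.List.Relation.Unary.Any using (here; there; any?)
  import Data.List.Relation.Unary.All as All
  open import Data.List.Relation.Unary.All.Properties using (¬Any⇒All¬)
  open import Data.Product using (Σ; _×_; _,_; proj₁; proj₂)
  open import Data.Sum as Sum using (_⊎_; inj₁; inj₂)
  open import Relation.Binary.Definitions using (tri<; tri≈; tri>)
  open import Relation.Binary.PropositionalEquality
  open import Relation.Nullary using (yes; no)
  open import Function using (_∘_)
  open +-*-Solver using (solve; _:=_; _:+_; _:*_; _:-_; :-_; con)

  private
    variable
      m : ℕ

  Constraint : ℕ → Set
  Constraint m = Vect m × ℚ

  Sat : Vect m → Constraint m → Set
  Sat x (a , b) = b ≤ dot a x

  Solution : List (Constraint m) → Vect m → Set
  Solution L x = ∀ {c} → c ∈ L → Sat x c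

  Feasible : List (Constraint m) → Set
  Feasible {m} L = Σ (Vect m) (Solution L)

  data Derivable (L : List (Constraint m)) : Vect m → ℚ → Set where
    hyp    : ∀ {a b} → (a , b) ∈ L → Derivable L a b
    add    : ∀ {a b a′ b′} → Derivable L a b → Derivable L a′ b′ →
             Derivable L (λ i → a i + a′ i) (b + b′)
    scale  : ∀ {a b} c → 0ℚ ≤ c → Derivable L a b → Derivable L (λ i → c * a i) (c * b)
    weaken : ∀ {a a′ b b′} → (∀ i → a i ≡ a′ i) → b′ ≤ b → Derivable L a b → Derivable L a′ b′

  Refutation : List (Constraint m) → Set
  Refutation L = Σ ℚ λ b → 0ℚ < b × Derivable L (λ _ → 0ℚ) b

  _⊕_ : Constraint m → Constraint m → Constraint m
  (a , b) ⊕ (a′ , b′) = (λ i → a i + a′ i) , b + b′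

  farkas-0 : (L : List (Constraint 0)) → Feasible L ⊎ Refutation L
  farkas-0 L with any? (λ c → 0ℚ <? proj₂ c) L
  ... | yes ∃b>0 with find ∃b>0
  ...   | (a , b) , c∈L , 0<b = inj₂ (b , 0<b , weaken (λ ()) ≤-refl (hyp c∈L))
  farkas-0 L | no ∄b>0 = inj₁ ((λ ()) , λ c∈L → ≮⇒≥ (All.lookup (¬Any⇒All¬ L ∄b>0) c∈L))

  module Elimination {k : ℕ} (L : List (Constraint (suc k))) where

    -- A constraint of L scaled so that its x₀-coefficient is 1, -1 or 0.
    data Normalised (c : Constraint (suc k)) : Set where
      lower : ∀ a b → Derivable L (1ℚ ∷ a) b →
              (∀ x₀ x → b ≤ x₀ + dot a x → Sat (x₀ ∷ x) c) → Normalised c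
      upper : ∀ a b → Derivable L (- 1ℚ ∷ a) b →
              (∀ x₀ x → b ≤ - x₀ + dot a x → Sat (x₀ ∷ x) c) → Normalised c
      free  : ∀ a b → Derivable L (0ℚ ∷ a) b →
              (∀ x₀ x → b ≤ dot a x → Sat (x₀ ∷ x) c) → Normalised c

    scaled-derivable : ∀ {a b} → (a , b) ∈ L → ∀ {s h} → 0ℚ ≤ s → s * a zero ≡ h →
                       Derivable L (h ∷ (λ i → s * a (suc i))) (s * b)
    scaled-derivable c∈L 0≤s sa₀≡h = weaken (λ { zero → sa₀≡h ; (suc i) → refl }) ≤-refl (scale _ 0≤s (hyp c∈L))

    scaled-sound : ∀ {a : Vect (suc k)} {b s h} → 0ℚ < s → s * a zero ≡ h →
                   ∀ x₀ x → s * b ≤ h * x₀ + dot (λ i → s * a (suc i)) x → Sat (x₀ ∷ x) (a , b)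
    scaled-sound {a} {b} {s} {h} 0<s sa₀≡h x₀ x sb≤ = *-cancelˡ-≤-pos s {{positive 0<s}} (subst (s * b ≤_) eq sb≤)
      where
      eq : h * x₀ + dot (λ i → s * a (suc i)) x ≡ s * (a zero * x₀ + dot (tail a) x)
      eq = trans (cong₂ (λ h t → h * x₀ + t) (sym sa₀≡h) (dot-*ˡ s (tail a) x))
        (solve 4 (λ s a₀ x₀ t → s :* a₀ :* x₀ :+ s :* t := s :* (a₀ :* x₀ :+ t)) refl
          s (a zero) x₀ (dot (tail a) x))

    normalise : ∀ {c} → c ∈ L → Normalised c
    normalise {a , b} c∈L with <-cmp (a zero) 0ℚ
    ... | tri≈ _ a₀≡0 _ = free (tail a) b
      (weaken (λ { zero → a₀≡0 ; (suc i) → refl }) ≤-refl (hyp c∈L))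
      (λ x₀ x b≤ → subst (b ≤_) (sym (trans (cong (λ h → h * x₀ + dot (tail a) x) a₀≡0)
                     (trans (cong (_+ dot (tail a) x) (*-zeroˡ x₀)) (+-identityˡ _)))) b≤)
    ... | tri> _ _ a₀>0 = lower _ _ (scaled-derivable c∈L (<⇒≤ 0<s) sa₀≡1)
      (λ x₀ x → scaled-sound {a} 0<s sa₀≡1 x₀ x ∘ subst (_ ≤_) (cong (_+ _) (sym (*-identityˡ x₀))))
      where
      0<s : 0ℚ < recip (a zero)
      0<s = recip-pos a₀>0
      sa₀≡1 : recip (a zero) * a zero ≡ 1ℚ
      sa₀≡1 = *-recipˡ (a zero) (pos⇒≢0 a₀>0)
    ... | tri< a₀<0 _ _ = upper _ _ (scaled-derivable c∈L (<⇒≤ 0<s) sa₀≡-1)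
      (λ x₀ x → scaled-sound {a} 0<s sa₀≡-1 x₀ x ∘ subst (_ ≤_) (cong (_+ _) (solve 1 (λ x → :- x := :- con 1ℚ :* x) refl x₀)))
      where
      0<-a₀ : 0ℚ < - a zero
      0<-a₀ = neg-antimono-< a₀<0
      0<s : 0ℚ < recip (- a zero)
      0<s = recip-pos 0<-a₀
      sa₀≡-1 : recip (- a zero) * a zero ≡ - 1ℚ
      sa₀≡-1 = trans (solve 2 (λ s a → s :* a := :- (s :* (:- a))) refl (recip (- a zero)) (a zero))
                     (cong -_ (*-recipˡ (- a zero) (pos⇒≢0 0<-a₀)))

    LowerBound : ℚ → Vect k → Constraint k → Set
    LowerBound x₀ x (a , b) = b ≤ x₀ + dot a x

    UpperBound : ℚ → Vect k → Constraint k → Set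
    UpperBound x₀ x (a , b) = b ≤ - x₀ + dot a x

    record Eliminated (cs : List (Constraint (suc k))) : Set where
      field
        lowers uppers frees : List (Constraint k)
        lower-derivable : ∀ {a b} → (a , b) ∈ lowers → Derivable L (1ℚ ∷ a) b
        upper-derivable : ∀ {a b} → (a , b) ∈ uppers → Derivable L (- 1ℚ ∷ a) b
        free-derivable  : ∀ {a b} → (a , b) ∈ frees → Derivable L (0ℚ ∷ a) b
        sound : ∀ x₀ x → (∀ {c} → c ∈ lowers → LowerBound x₀ x c) →
                (∀ {c} → c ∈ uppers → UpperBound x₀ x c) → Solution frees x →
                Solution cs (x₀ ∷ x)

    eliminate : ∀ {cs} → All.All Normalised cs → Eliminated cs
    eliminate All.[] = record
      { lowers = List.[] ; uppers = List.[] ; frees = List.[]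
      ; lower-derivable = λ () ; upper-derivable = λ () ; free-derivable = λ ()
      ; sound = λ _ _ _ _ _ () }
    eliminate (lower a b d s All.∷ ns) = record
      { lowers = (a , b) List.∷ lowers ; uppers = uppers ; frees = frees
      ; lower-derivable = λ { (here refl) → d ; (there c∈) → lower-derivable c∈ }
      ; upper-derivable = upper-derivable ; free-derivable = free-derivable
      ; sound = λ x₀ x lo up fr → λ { (here refl) → s x₀ x (lo (here refl))
                                    ; (there c∈) → sound x₀ x (lo ∘ there) up fr c∈ } }
      where open Eliminated (eliminate ns)
    eliminate (upper a b d s All.∷ ns) = record
      { lowers = lowers ; uppers = (a , b) List.∷ uppers ; frees = frees
      ; lower-derivable = lower-derivable ; free-derivable = free-derivable
      ; upper-derivable = λ { (here refl) → d ; (there c∈) → upper-derivable c∈ }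
      ; sound = λ x₀ x lo up fr → λ { (here refl) → s x₀ x (up (here refl))
                                    ; (there c∈) → sound x₀ x lo (up ∘ there) fr c∈ } }
      where open Eliminated (eliminate ns)
    eliminate (free a b d s All.∷ ns) = record
      { lowers = lowers ; uppers = uppers ; frees = (a , b) List.∷ frees
      ; lower-derivable = lower-derivable ; upper-derivable = upper-derivable
      ; free-derivable = λ { (here refl) → d ; (there c∈) → free-derivable c∈ }
      ; sound = λ x₀ x lo up fr → λ { (here refl) → s x₀ x (fr (here refl))
                                    ; (there c∈) → sound x₀ x lo up (fr ∘ there) c∈ } }
      where open Eliminated (eliminate ns)

    open Eliminated (eliminate (All.tabulate normalise))

    -- Summing a lower and an upper bound cancels x₀.
    reduced : List (Constraint k)
    reduced = frees ++ cartesianProductWith _⊕_ lowers uppers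

    lift : ∀ {a b} → Derivable reduced a b → Derivable L (0ℚ ∷ a) b
    lift (hyp c∈) with ∈-++⁻ frees c∈
    ... | inj₁ c∈frees = free-derivable c∈frees
    ... | inj₂ c∈pairs with ∈-cartesianProductWith⁻ _⊕_ lowers uppers c∈pairs
    ...   | _ , _ , l∈ , u∈ , refl = weaken (λ { zero → +-inverseʳ 1ℚ ; (suc i) → refl }) ≤-refl
            (add (lower-derivable l∈) (upper-derivable u∈))
    lift (add d d′) = weaken (λ { zero → +-identityʳ 0ℚ ; (suc i) → refl }) ≤-refl (add (lift d) (lift d′))
    lift (scale c 0≤c d) = weaken (λ { zero → *-zeroʳ c ; (suc i) → refl }) ≤-refl (scale c 0≤c (lift d))
    lift (weaken a≗a′ b′≤b d) = weaken (λ { zero → refl ; (suc i) → a≗a′ i }) b′≤b (lift d)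

    module _ (x : Vect k) where

      lowest highest : Constraint k → ℚ
      lowest (a , b) = b - dot a x
      highest (a , b) = dot a x - b

      lowest≤highest : ∀ {l u} → Sat x (l ⊕ u) → lowest l ≤ highest u
      lowest≤highest {a , b} {a′ , b′} sat = ≤-by-difference (subst (_ ≤_) (dot-+ˡ a a′ x) sat)
        (solve 4 (λ b d b′ d′ → (d :+ d′) :- (b :+ b′) := (d′ :- b′) :- (b :- d)) refl b (dot a x) b′ (dot a′ x))

      lowest≤⇒LowerBound : ∀ {x₀ c} → lowest c ≤ x₀ → LowerBound x₀ x c
      lowest≤⇒LowerBound {x₀} {a , b} ≤x₀ = ≤-by-difference ≤x₀
        (solve 3 (λ x₀ b d → x₀ :- (b :- d) := (x₀ :+ d) :- b) refl x₀ b (dot a x))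

      ≤highest⇒UpperBound : ∀ {x₀ c} → x₀ ≤ highest c → UpperBound x₀ x c
      ≤highest⇒UpperBound {x₀} {a , b} x₀≤ = ≤-by-difference x₀≤
        (solve 3 (λ x₀ b d → (d :- b) :- x₀ := (:- x₀ :+ d) :- b) refl x₀ b (dot a x))

      extend : Solution reduced x → Σ ℚ λ x₀ → Solution L (x₀ ∷ x)
      extend sol = x₀ , sound x₀ x (λ {c} c∈ → lowest≤⇒LowerBound {c = c} (lo c∈))
                                   (λ {c} c∈ → ≤highest⇒UpperBound {c = c} (up c∈)) (sol ∘ ∈-++⁺ˡ)
        where
        paired : ∀ {l u} → l ∈ lowers → u ∈ uppers → lowest l ≤ highest u
        paired {l} {u} l∈ u∈ = lowest≤highest {l} {u} (sol (∈-++⁺ʳ frees (∈-cartesianProductWith⁺ _⊕_ l∈ u∈)))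
        separated : Σ ℚ λ x₀ → (∀ {l} → l ∈ lowers → lowest l ≤ x₀) × (∀ {u} → u ∈ uppers → x₀ ≤ highest u)
        separated = separating-point lowest highest lowers uppers paired
        x₀ : ℚ
        x₀ = proj₁ separated
        lo : ∀ {l} → l ∈ lowers → lowest l ≤ x₀
        lo = proj₁ (proj₂ separated)
        up : ∀ {u} → u ∈ uppers → x₀ ≤ highest u
        up = proj₂ (proj₂ separated)

  farkas : ∀ m (L : List (Constraint m)) → Feasible L ⊎ Refutation L
  farkas zero    L = farkas-0 L
  farkas (suc k) L = Sum.map
    (λ (x , sol) → proj₁ (extend x sol) ∷ x , proj₂ (extend x sol))
    (λ (b , 0<b , d) → b , 0<b , weaken (λ { zero → refl ; (suc i) → refl }) ≤-refl (lift d))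
    (farkas k reduced)
    where open Elimination L

module VertexBound where

  open import Defs using (Vect; dot; Family; Extreme; recip)
  open RationalFacts
  open FiniteSums
  open ListFacts using (minimiser; count; count-mono-<)
  open FourierMotzkin using (Constraint; Sat; Solution)
  open import Data.Nat as ℕ using (ℕ)
  open import Data.Nat.Induction using (<-wellFounded)
  open import Data.Rational
  open import Data.Rational.Properties
  open import Data.Rational.Solver
  open import Data.List using (List; _∷_; filter)
  open import Data.List.Membership.Propositional using (_∈_; find)
  open import Data.List.Membership.Propositional.Properties using (∈-filter⁺; ∈-filter⁻)
  open import Data.List.Relation.Unary.Any using (here; there; any?)
  import Data.List.Relation.Unary.All as All
  open import Data.List.Relation.Unary.All.Properties using (¬Any⇒All¬)
  open import Data.Product using (_×_; _,_; proj₁; proj₂)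
  open import Data.Sum using (_⊎_; inj₁; inj₂)
  open import Data.Empty using (⊥-elim)
  open import Function using (_∘_)
  open import Induction.WellFounded using (WellFounded; module All)
  import Relation.Binary.Construct.On as On
  open import Relation.Binary.PropositionalEquality
  open import Relation.Nullary using (¬_; ¬?; Dec; yes; no)
  open import Relation.Nullary.Decidable using (decidable-stable)
  open +-*-Solver

  record Presentation {n} (P : Family n) : Set where
    field
      constraints : List (Constraint n)
      sound       : ∀ {x} → P x → Solution constraints x
      complete    : ∀ {x} → Solution constraints x → P x
      sign        : ∀ e → (unit e , 0ℚ) ∈ constraints

  module _ {n : ℕ} where

    Tight : Vect n → Constraint n → Set
    Tight x (a , b) = b ≡ dot a x

    tight-on-segment : ∀ {x y z t} {c : Constraint n} → Sat y c → Sat z c → 0ℚ < t → t < 1ℚ →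
                       (∀ e → x e ≡ t * y e + (1ℚ - t) * z e) →
                       Tight x c → dot (proj₁ c) (λ e → y e - z e) ≡ 0ℚ
    tight-on-segment {x} {y} {z} {t} {a , b} sat-y sat-z 0<t t<1 x≡ tight = begin
      dot a (λ e → y e - z e) ≡⟨ dot-comm a _ ⟩
      dot (λ e → y e - z e) a ≡⟨ dot-subˡ y z a ⟩
      dot y a - dot z a       ≡⟨ solve 3 (λ Y Z b → Y :- Z := (Y :- b) :- (Z :- b)) refl (dot y a) (dot z a) b ⟩
      u - v                   ≡⟨ cong₂ _-_ u≡0 v≡0 ⟩
      0ℚ - 0ℚ                 ≡⟨⟩
      0ℚ                      ∎
      where
      open ≡-Reasoning
      u = dot y a - b
      v = dot z a - b
      0≤tu : 0ℚ ≤ t * u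
      0≤tu = *-nonNeg (<⇒≤ 0<t) (p≤q⇒0≤q-p (subst (b ≤_) (dot-comm a y) sat-y))
      0≤[1-t]v : 0ℚ ≤ (1ℚ - t) * v
      0≤[1-t]v = *-nonNeg (<⇒≤ (p<q⇒0<q-p t<1)) (p≤q⇒0≤q-p (subst (b ≤_) (dot-comm a z) sat-z))
      dot-x : dot x a ≡ t * dot y a + (1ℚ - t) * dot z a
      dot-x = trans (dot-cong x≡ (λ _ → refl))
        (trans (dot-+ˡ (λ e → t * y e) (λ e → (1ℚ - t) * z e) a) (cong₂ _+_ (dot-*ˡ t y a) (dot-*ˡ (1ℚ - t) z a)))
      sum≡0 : t * u + (1ℚ - t) * v ≡ 0ℚ
      sum≡0 = begin
        t * u + (1ℚ - t) * v ≡⟨ solve 4 (λ t Y Z b → t :* (Y :- b) :+ (con 1ℚ :- t) :* (Z :- b)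
                                                 := (t :* Y :+ (con 1ℚ :- t) :* Z) :- b) refl t (dot y a) (dot z a) b ⟩
        (t * dot y a + (1ℚ - t) * dot z a) - b ≡⟨ cong (_- b) (sym dot-x) ⟩
        dot x a - b          ≡⟨ cong (_- b) (trans (dot-comm x a) (sym tight)) ⟩
        b - b                ≡⟨ +-inverseʳ b ⟩
        0ℚ                   ∎
      u≡0 = pos*≡0⇒≡0 0<t (nonNeg+nonNeg≡0⇒ˡ≡0 0≤tu 0≤[1-t]v sum≡0)
      v≡0 = pos*≡0⇒≡0 (p<q⇒0<q-p t<1)
              (nonNeg+nonNeg≡0⇒ˡ≡0 0≤[1-t]v 0≤tu (trans (+-comm ((1ℚ - t) * v) (t * u)) sum≡0))

  module _ {n : ℕ} {P : Family n} (pres : Presentation P) where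

    open Presentation pres renaming (constraints to C)

    Slack : Vect n → Constraint n → Set
    Slack x c = ¬ Tight x c

    slack? : ∀ x c → Dec (Slack x c)
    slack? x (a , b) = ¬? (b ≟ dot a x)

    slackCount : Vect n → ℕ
    slackCount x = count (slack? x) C

    _-_·_ : Vect n → ℚ → Vect n → Vect n
    (x - s · d) e = x e - s * d e

    record LineStep (x d : Vect n) : Set where
      field
        s           : ℚ
        0<s         : 0ℚ < s
        stays       : P (x - s · d)
        fewer-slack : slackCount (x - s · d) ℕ.< slackCount x

    module _ (x d : Vect n) (Px : P x) (tight⇒⊥d : ∀ {c} → c ∈ C → Tight x c → dot (proj₁ c) d ≡ 0ℚ) where

      Blocking : Constraint n → Set
      Blocking c = 0ℚ < dot (proj₁ c) d

      blocking? : (c : Constraint n) → Dec (Blocking c)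
      blocking? c = 0ℚ <? dot (proj₁ c) d

      ratio : Constraint n → ℚ
      ratio (a , b) = (dot a x - b) * recip (dot a d)

      ratio-spec : ∀ {a b} → 0ℚ < dot a d → ratio (a , b) * dot a d ≡ dot a x - b
      ratio-spec {a} {b} 0<ad = trans (*-assoc (dot a x - b) (recip (dot a d)) (dot a d))
        (trans (cong ((dot a x - b) *_) (*-recipˡ (dot a d) (pos⇒≢0 0<ad))) (*-identityʳ _))

      -- Moving from x against d, the blocking constraint of least ratio becomes tight first.
      step-to : ∀ {c*} → c* ∈ C → Blocking c* → (∀ {c} → c ∈ C → Blocking c → ratio c* ≤ ratio c) → LineStep x d
      step-to {a* , b*} c*∈C blocking minimal = record
        { s = s ; 0<s = 0<s ; stays = complete sat
        ; fewer-slack = count-mono-< _ _ C (λ c∈ slack′ t → slack′ (stays-tight c∈ t)) c*∈C ¬tight-x (λ slack′ → slack′ tight-x′) }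
        where
        s : ℚ
        s = ratio (a* , b*)
        ¬tight-x : ¬ Tight x (a* , b*)
        ¬tight-x t = <-irrefl (sym (tight⇒⊥d c*∈C t)) blocking
        0<s : 0ℚ < s
        0<s = *-pos (p<q⇒0<q-p (≤∧≢⇒< (sound Px c*∈C) ¬tight-x)) (recip-pos blocking)
        moved : ∀ a → dot a (x - s · d) ≡ dot a x - s * dot a d
        moved a = dot-sub-scaledʳ a x d s
        stays-tight : ∀ {c} → c ∈ C → Tight x c → Tight (x - s · d) c
        stays-tight {a , b} c∈ t = trans t (sym (trans (moved a)
          (trans (cong (λ v → dot a x - s * v) (tight⇒⊥d c∈ t))
                 (solve 2 (λ X s → X :- s :* con 0ℚ := X) refl (dot a x) s))))
        tight-x′ : Tight (x - s · d) (a* , b*)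
        tight-x′ = sym (trans (moved a*) (trans (cong (λ v → dot a* x - v) (ratio-spec {a*} {b*} blocking))
          (solve 2 (λ X b → X :- (X :- b) := b) refl (dot a* x) b*)))
        sat : Solution C (x - s · d)
        sat {a , b} c∈ = subst (b ≤_) (sym (moved a)) (sat′ (blocking? (a , b)))
          where
          sat′ : Dec (Blocking (a , b)) → b ≤ dot a x - s * dot a d
          sat′ (no ¬blocking) = ≤-trans (sound Px c∈) (≤-by-difference
            (*-nonNeg (<⇒≤ 0<s) (neg-antimono-≤ (≮⇒≥ ¬blocking)))
            (solve 3 (λ X s D → s :* (:- D) :- con 0ℚ := (X :- s :* D) :- X) refl (dot a x) s (dot a d)))
          sat′ (yes blocking′) = ≤-by-difference s·ad≤
            (solve 4 (λ X b s D → (X :- b) :- s :* D := (X :- s :* D) :- b) refl (dot a x) b s (dot a d))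
            where
            s·ad≤ : s * dot a d ≤ dot a x - b
            s·ad≤ = subst (s * dot a d ≤_) (ratio-spec {a} {b} blocking′)
                      (*-monoʳ-≤-0≤ (dot a d) (<⇒≤ blocking′) (minimal c∈ blocking′))

      step-from : ∀ {c₀} → c₀ ∈ C → Blocking c₀ → LineStep x d
      step-from {c₀} c₀∈C c₀-blocking with minimiser ratio c₀ (filter blocking? C)
      ... | c* , c*∈ , minimal = step-to (proj₁ (candidate c*∈)) (proj₂ (candidate c*∈))
                                   (λ c∈ blocking → minimal (there (∈-filter⁺ blocking? c∈ blocking)))
        where
        candidate : ∀ {c} → c ∈ c₀ ∷ filter blocking? C → c ∈ C × Blocking c
        candidate (here refl) = c₀∈C , c₀-blocking
        candidate (there c∈) = ∈-filter⁻ blocking? c∈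

      step-or-nonPos : LineStep x d ⊎ (∀ e → d e ≤ 0ℚ)
      step-or-nonPos with any? blocking? C
      ... | yes ∃blocking = let _ , c∈C , blocking = find ∃blocking in inj₁ (step-from c∈C blocking)
      ... | no ∄blocking = inj₂ λ e →
        subst (_≤ 0ℚ) (dot-unitˡ e d) (≮⇒≥ (All.lookup (¬Any⇒All¬ C ∄blocking) (sign e)))

    private
      ≤-downhill : ∀ {β X D s} → 0ℚ ≤ s → 0ℚ ≤ D → β ≤ X - s * D → β ≤ X
      ≤-downhill {β} {X} {D} {s} 0≤s 0≤D β≤ = ≤-trans β≤ (≤-by-difference (*-nonNeg 0≤s 0≤D)
        (solve 3 (λ X D s → s :* D :- con 0ℚ := X :- (X :- s :* D)) refl X D s))

      ≤-both-ways : ∀ {β X D s s′} → 0ℚ < s → 0ℚ < s′ → β ≤ X - s * D → β ≤ X - s′ * (- D) → β ≤ X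
      ≤-both-ways {β} {X} {D} {s} {s′} 0<s 0<s′ β≤₁ β≤₂ =
        0≤q-p⇒p≤q (*-cancelˡ-≤-pos (s + s′) {{positive (+-mono-< 0<s 0<s′)}}
          (subst₂ _≤_ (sym (*-zeroʳ (s + s′))) eq (+-nonNeg weighted₁ weighted₂)))
        where
        weighted₁ : 0ℚ ≤ s′ * (X - s * D) - s′ * β
        weighted₁ = p≤q⇒0≤q-p (*-monoˡ-≤-0≤ s′ (<⇒≤ 0<s′) β≤₁)
        weighted₂ : 0ℚ ≤ s * (X - s′ * (- D)) - s * β
        weighted₂ = p≤q⇒0≤q-p (*-monoˡ-≤-0≤ s (<⇒≤ 0<s) β≤₂)
        eq : (s′ * (X - s * D) - s′ * β) + (s * (X - s′ * (- D)) - s * β) ≡ (s + s′) * (X - β)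
        eq = solve 5 (λ β X D s s′ → (s′ :* (X :- s :* D) :- s′ :* β) :+ (s :* (X :- s′ :* (:- D)) :- s :* β)
                                    := (s :+ s′) :* (X :- β)) refl β X D s s′

    module _ (η : Vect n) (0≤η : ∀ e → 0ℚ ≤ η e) (β : ℚ) (vertices : ∀ v → Extreme P v → β ≤ dot v η) where

      _≺_ : Vect n → Vect n → Set
      x ≺ y = slackCount x ℕ.< slackCount y

      ≺-wellFounded : WellFounded _≺_
      ≺-wellFounded = On.wellFounded slackCount <-wellFounded

      module _ {x} (Px : P x) (ih : ∀ {y} → y ≺ x → P y → β ≤ dot y η) where

        after-step : ∀ {d} (st : LineStep x d) → β ≤ dot x η - LineStep.s st * dot d η
        after-step {d} st = subst (β ≤_) (dot-sub-scaledˡ x d η s) (ih fewer-slack stays)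
          where open LineStep st

        module _ {y z t} (Py : P y) (Pz : P z) (0<t : 0ℚ < t) (t<1 : t < 1ℚ)
                 (x≡ : ∀ e → x e ≡ t * y e + (1ℚ - t) * z e) where

          d -d : Vect n
          d e = y e - z e
          -d e = - d e

          ⊥d : ∀ {c} → c ∈ C → Tight x c → dot (proj₁ c) d ≡ 0ℚ
          ⊥d {c} c∈ = tight-on-segment {c = c} (sound Py c∈) (sound Pz c∈) 0<t t<1 x≡

          ⊥-d : ∀ {c} → c ∈ C → Tight x c → dot (proj₁ c) -d ≡ 0ℚ
          ⊥-d {c} c∈ t = trans (dot-negʳ (proj₁ c) d) (cong -_ (⊥d c∈ t))

          bound-from-directions : LineStep x d ⊎ (∀ e → d e ≤ 0ℚ) → LineStep x -d ⊎ (∀ e → -d e ≤ 0ℚ) →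
                        ∀ e → ¬ y e ≡ z e → β ≤ dot x η
          bound-from-directions (inj₁ st) (inj₁ st′) _ _ = ≤-both-ways (LineStep.0<s st) (LineStep.0<s st′) (after-step st)
            (subst (λ v → β ≤ dot x η - LineStep.s st′ * v) (dot-negˡ d η) (after-step st′))
          bound-from-directions (inj₁ st) (inj₂ -d≤0) _ _ =
            ≤-downhill (<⇒≤ (LineStep.0<s st)) (dot-nonNeg (-p≤0⇒0≤p ∘ -d≤0) 0≤η) (after-step st)
          bound-from-directions (inj₂ d≤0) (inj₁ st′) _ _ =
            ≤-downhill (<⇒≤ (LineStep.0<s st′)) (dot-nonNeg (λ e → neg-antimono-≤ (d≤0 e)) 0≤η) (after-step st′)
          bound-from-directions (inj₂ d≤0) (inj₂ -d≤0) e y≢z = ⊥-elim (y≢z (p-q≡0⇒p≡q (≤-antisym (d≤0 e) (-p≤0⇒0≤p (-d≤0 e)))))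

          off-vertex : ∀ e → ¬ y e ≡ z e → β ≤ dot x η
          off-vertex = bound-from-directions (step-or-nonPos x d Px ⊥d) (step-or-nonPos x -d Px ⊥-d)

      -- If x is not extreme, it is inside a
      -- segment of P whose direction d is orthogonal to every constraint tight at x. Moving
      -- from x along ±d until one more constraint becomes tight stays in P with fewer slack
      -- constraints, and the bound there transfers back to x by linearity; a direction in
      -- which nothing blocks is ≤ 0 by the sign constraints, and then η ≥ 0 does the job.
      vertex-bound : ∀ x → P x → β ≤ dot x η
      vertex-bound = All.wfRec ≺-wellFounded _ (λ x → P x → β ≤ dot x η) λ x ih Px →
        decidable-stable (β ≤? dot x η) λ ¬above → ¬above (vertices x (Px ,
          λ y z t Py Pz 0<t t<1 x≡ e → decidable-stable (y e ≟ z e) λ y≢z →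
            ¬above (off-vertex Px (λ y≺x → ih y≺x) Py Pz 0<t t<1 x≡ e y≢z)))

module BlockerDuality where

  open import Defs using (Vect; Σ[_]; dot; recip)
  open RationalFacts
  open FiniteSums
  open FourierMotzkin
  open import Data.Nat using (ℕ)
  open import Data.Fin using (Fin)
  open import Data.Rational
  open import Data.Rational.Properties
  open import Data.Rational.Solver
  open import Data.List using (List; _∷_; _++_; map; allFin)
  open import Data.List.Membership.Propositional using (_∈_)
  open import Data.List.Membership.Propositional.Properties using (∈-map⁺; ∈-map⁻; ∈-++⁺ˡ; ∈-++⁺ʳ; ∈-++⁻; ∈-allFin)
  open import Data.List.Relation.Unary.Any using (here; there)
  open import Data.Product using (Σ; _×_; _,_)
  open import Data.Sum using (inj₁; inj₂; [_,_]′)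
  open import Function using (_∘_)
  open import Relation.Nullary using (¬_)
  open import Data.Empty using (⊥-elim)
  open import Relation.Binary.PropositionalEquality
  open +-*-Solver using (solve; _:=_; _:+_; _:*_; _:-_; :-_; con)

  module _ {m n : ℕ} (v : Fin m → Vect n) (η : Vect n) where

    sign-constraint : Fin m → Constraint m
    sign-constraint i = unit i , 0ℚ

    mass-constraint : Constraint m
    mass-constraint = (λ _ → 1ℚ) , 1ℚ

    dominance-constraint : Fin n → Constraint m
    dominance-constraint e = (λ i → - v i e) , - η e

    -- λ ≥ 0, Σᵢ λᵢ ≥ 1 and Σᵢ λᵢ vᵢ ≤ η
    system : List (Constraint m)
    system = map sign-constraint (allFin m) ++ mass-constraint ∷ map dominance-constraint (allFin n)

    -- Dual multipliers of a derivable constraint: β for the mass constraint and ρ for the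
    -- dominance constraints; those of the sign constraints are the slack in covers.
    record Certificate (a : Vect m) (b : ℚ) : Set where
      field
        β      : ℚ
        ρ      : Vect n
        0≤β    : 0ℚ ≤ β
        0≤ρ    : ∀ e → 0ℚ ≤ ρ e
        covers : ∀ i → β - dot (v i) ρ ≤ a i
        bound  : b ≤ β - dot ρ η

    certificate-hyp : ∀ {a b} → (a , b) ∈ system → Certificate a b
    certificate-hyp c∈ with ∈-++⁻ (map sign-constraint (allFin m)) c∈
    ... | inj₁ c∈signs with ∈-map⁻ sign-constraint c∈signs
    ...   | i , _ , refl = record
      { β = 0ℚ ; ρ = λ _ → 0ℚ ; 0≤β = ≤-refl ; 0≤ρ = λ _ → ≤-refl
      ; covers = λ j → subst (_≤ unit i j) (sym (cong (λ u → 0ℚ - u) (dot-0ʳ (v j)))) (unit-nonNeg i j)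
      ; bound = ≤-reflexive (sym (cong (λ u → 0ℚ - u) (dot-0ˡ η))) }
    certificate-hyp c∈ | inj₂ (here refl) = record
      { β = 1ℚ ; ρ = λ _ → 0ℚ ; 0≤β = 0≤1 ; 0≤ρ = λ _ → ≤-refl
      ; covers = λ j → ≤-reflexive (cong (λ u → 1ℚ - u) (dot-0ʳ (v j)))
      ; bound = ≤-reflexive (sym (cong (λ u → 1ℚ - u) (dot-0ˡ η))) }
    certificate-hyp c∈ | inj₂ (there c∈dominance) with ∈-map⁻ dominance-constraint c∈dominance
    ... | e , _ , refl = record
      { β = 0ℚ ; ρ = unit e ; 0≤β = ≤-refl ; 0≤ρ = unit-nonNeg e
      ; covers = λ j → ≤-reflexive (trans (cong (λ u → 0ℚ - u) (trans (dot-comm (v j) (unit e)) (dot-unitˡ e (v j))))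
                                          (+-identityˡ _))
      ; bound = ≤-reflexive (sym (trans (cong (λ u → 0ℚ - u) (dot-unitˡ e η)) (+-identityˡ _))) }

    certificate : ∀ {a b} → Derivable system a b → Certificate a b
    certificate (hyp c∈) = certificate-hyp c∈
    certificate (add d d′) = record
      { β = β + β′ ; ρ = λ e → ρ e + ρ′ e ; 0≤β = +-nonNeg 0≤β 0≤β′ ; 0≤ρ = λ e → +-nonNeg (0≤ρ e) (0≤ρ′ e)
      ; covers = λ i → subst (_≤ _) (sym (trans (cong (λ u → β + β′ - u) (dot-+ʳ (v i) ρ ρ′)) (regroup β β′ _ _)))
                         (+-mono-≤ (covers i) (covers′ i))
      ; bound = ≤-trans (+-mono-≤ bound bound′)
                  (≤-reflexive (sym (trans (cong (λ u → β + β′ - u) (dot-+ˡ ρ ρ′ η)) (regroup β β′ _ _)))) }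
      where
      open Certificate (certificate d)
      open Certificate (certificate d′) renaming (β to β′; ρ to ρ′; 0≤β to 0≤β′; 0≤ρ to 0≤ρ′; covers to covers′; bound to bound′)
      regroup : ∀ β β′ X X′ → β + β′ - (X + X′) ≡ (β - X) + (β′ - X′)
      regroup = solve 4 (λ β β′ X X′ → β :+ β′ :- (X :+ X′) := (β :- X) :+ (β′ :- X′)) refl
    certificate (scale c 0≤c d) = record
      { β = c * β ; ρ = λ e → c * ρ e ; 0≤β = *-nonNeg 0≤c 0≤β ; 0≤ρ = λ e → *-nonNeg 0≤c (0≤ρ e)
      ; covers = λ i → subst (_≤ _) (sym (trans (cong (λ u → c * β - u) (dot-*ʳ c (v i) ρ)) (factor c β _)))
                         (*-monoˡ-≤-0≤ c 0≤c (covers i))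
      ; bound = ≤-trans (*-monoˡ-≤-0≤ c 0≤c bound)
                  (≤-reflexive (sym (trans (cong (λ u → c * β - u) (dot-*ˡ c ρ η)) (factor c β _)))) }
      where
      open Certificate (certificate d)
      factor : ∀ c β X → c * β - c * X ≡ c * (β - X)
      factor = solve 3 (λ c β X → c :* β :- c :* X := c :* (β :- X)) refl
    certificate (weaken a≗a′ b′≤b d) = record
      { β = β ; ρ = ρ ; 0≤β = 0≤β ; 0≤ρ = 0≤ρ
      ; covers = λ i → subst (_ ≤_) (a≗a′ i) (covers i) ; bound = ≤-trans b′≤b bound }
      where open Certificate (certificate d)

    refuted⇒cheap-admissible : (∀ e → 0ℚ ≤ η e) → Refutation system →
      Σ (Vect n) λ ρ → (∀ e → 0ℚ ≤ ρ e) × (∀ i → 1ℚ ≤ dot (v i) ρ) × dot ρ η < 1ℚ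
    refuted⇒cheap-admissible 0≤η (b , 0<b , d) = ρ′ , 0≤ρ′ , admissible , cheap
      where
      open Certificate (certificate d)
      ρη<β : dot ρ η < β
      ρη<β = 0<q-p⇒p<q (<-≤-trans 0<b bound)
      0<β : 0ℚ < β
      0<β = ≤-<-trans (dot-nonNeg 0≤ρ 0≤η) ρη<β
      β⁻¹ = recip β
      0<β⁻¹ = recip-pos 0<β
      ρ′ : Vect n
      ρ′ e = β⁻¹ * ρ e
      0≤ρ′ : ∀ e → 0ℚ ≤ ρ′ e
      0≤ρ′ e = *-nonNeg (<⇒≤ 0<β⁻¹) (0≤ρ e)
      admissible : ∀ i → 1ℚ ≤ dot (v i) ρ′
      admissible i = subst₂ _≤_ (*-recipˡ β (pos⇒≢0 0<β)) (sym (dot-*ʳ β⁻¹ (v i) ρ))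
        (*-monoˡ-≤-0≤ β⁻¹ (<⇒≤ 0<β⁻¹) (≤-by-difference (covers i)
          (solve 2 (λ β X → con 0ℚ :- (β :- X) := X :- β) refl β (dot (v i) ρ))))
      cheap : dot ρ′ η < 1ℚ
      cheap = subst₂ _<_ (sym (dot-*ˡ β⁻¹ ρ η)) (*-recipˡ β (pos⇒≢0 0<β))
        (*-monoʳ-<-pos β⁻¹ {{positive 0<β⁻¹}} ρη<β)

    feasible⇒dominated-combination : (∀ i e → 0ℚ ≤ v i e) → Feasible system →
      Σ (Fin m → ℚ) λ μ → (∀ i → 0ℚ ≤ μ i) × Σ[ μ ] ≡ 1ℚ × (∀ e → Σ[ (λ i → μ i * v i e) ] ≤ η e)
    feasible⇒dominated-combination 0≤v (λ′ , sol) = μ , 0≤μ , Σμ≡1 , dominated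
      where
      0≤λ : ∀ i → 0ℚ ≤ λ′ i
      0≤λ i = subst (0ℚ ≤_) (dot-unitˡ i λ′) (sol (∈-++⁺ˡ (∈-map⁺ sign-constraint (∈-allFin i))))
      Λ = Σ[ λ′ ]
      1≤Λ : 1ℚ ≤ Λ
      1≤Λ = subst (1ℚ ≤_) (Σ-cong (λ i → *-identityˡ (λ′ i)))
        (sol (∈-++⁺ʳ (map sign-constraint (allFin m)) (here refl)))
      0<Λ : 0ℚ < Λ
      0<Λ = <-≤-trans (positive⁻¹ 1ℚ) 1≤Λ
      Λ⁻¹ = recip Λ
      0≤Λ⁻¹ : 0ℚ ≤ Λ⁻¹
      0≤Λ⁻¹ = <⇒≤ (recip-pos 0<Λ)
      Λ⁻¹≤1 : Λ⁻¹ ≤ 1ℚ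
      Λ⁻¹≤1 = subst₂ _≤_ (*-identityʳ Λ⁻¹) (*-recipˡ Λ (pos⇒≢0 0<Λ)) (*-monoˡ-≤-0≤ Λ⁻¹ 0≤Λ⁻¹ 1≤Λ)
      μ : Fin m → ℚ
      μ i = Λ⁻¹ * λ′ i
      0≤μ : ∀ i → 0ℚ ≤ μ i
      0≤μ i = *-nonNeg 0≤Λ⁻¹ (0≤λ i)
      Σμ≡1 : Σ[ μ ] ≡ 1ℚ
      Σμ≡1 = trans (Σ-* Λ⁻¹ λ′) (*-recipˡ Λ (pos⇒≢0 0<Λ))
      λv : Vect n
      λv e = Σ[ (λ i → λ′ i * v i e) ]
      λv≤η : ∀ e → λv e ≤ η e
      λv≤η e = ≤-by-difference (sol (∈-++⁺ʳ (map sign-constraint (allFin m))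
                                       (there (∈-map⁺ dominance-constraint (∈-allFin e)))))
        (begin
          dot (λ i → - v i e) λ′ - - η e ≡⟨ cong (_- - η e) (dot-negˡ (λ i → v i e) λ′) ⟩
          - dot (λ i → v i e) λ′ - - η e ≡⟨ cong (λ u → - u - - η e) (dot-comm (λ i → v i e) λ′) ⟩
          - λv e - - η e                 ≡⟨ solve 2 (λ s h → :- s :- :- h := h :- s) refl (λv e) (η e) ⟩
          η e - λv e                     ∎)
        where open ≡-Reasoning
      dominated : ∀ e → Σ[ (λ i → μ i * v i e) ] ≤ η e
      dominated e = ≤-trans (≤-reflexive μv≡) (≤-trans Λ⁻¹λv≤λv (λv≤η e))
        where
        μv≡ : Σ[ (λ i → μ i * v i e) ] ≡ Λ⁻¹ * λv e
        μv≡ = trans (Σ-cong (λ i → *-assoc Λ⁻¹ (λ′ i) (v i e))) (Σ-* Λ⁻¹ (λ i → λ′ i * v i e))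
        Λ⁻¹λv≤λv : Λ⁻¹ * λv e ≤ λv e
        Λ⁻¹λv≤λv = subst (Λ⁻¹ * λv e ≤_) (*-identityˡ (λv e))
          (*-monoʳ-≤-0≤ (λv e) (Σ-nonNeg (λ i → *-nonNeg (0≤λ i) (0≤v i e))) Λ⁻¹≤1)

    -- By Farkas, either the system has a solution, which normalises to μ, or a refutation,
    -- whose certificate rescales to an admissible ρ with ρ · η < 1.
    dominated-combination : (∀ i e → 0ℚ ≤ v i e) → (∀ e → 0ℚ ≤ η e) →
      (∀ ρ → (∀ e → 0ℚ ≤ ρ e) → (∀ i → 1ℚ ≤ dot (v i) ρ) → 1ℚ ≤ dot ρ η) →
      Σ (Fin m → ℚ) λ μ → (∀ i → 0ℚ ≤ μ i) × Σ[ μ ] ≡ 1ℚ × (∀ e → Σ[ (λ i → μ i * v i e) ] ≤ η e)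
    dominated-combination 0≤v 0≤η blocking =
      [ feasible⇒dominated-combination 0≤v , ⊥-elim ∘ not-cheap ∘ refuted⇒cheap-admissible 0≤η ]′ (farkas m system)
      where
      not-cheap : ¬ Σ (Vect n) λ ρ → (∀ e → 0ℚ ≤ ρ e) × (∀ i → 1ℚ ≤ dot (v i) ρ) × dot ρ η < 1ℚ
      not-cheap (ρ , 0≤ρ , admissible , cheap) = <-irrefl refl (<-≤-trans cheap (blocking ρ 0≤ρ admissible))

module Modulus where

  open import Defs using (Vect; Σ[_]; dot; energy; Family; Adm; OptimalDensity)
  open RationalFacts
  open FiniteSums
  open import Data.Nat using (ℕ)
  open import Data.Rational
  open import Data.Rational.Properties
  open import Data.Rational.Solver
  open import Data.Product using (_,_)
  open import Relation.Binary.PropositionalEquality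
  open +-*-Solver using (solve; _:=_; _:+_; _:*_; _:-_; :-_; con)

  private
    variable
      n : ℕ

  -- x² - y² = (x - y)(x + y) ≥ (x - y)² when 0 ≤ y ≤ x.
  energy-squeeze : (x y : Vect n) → (∀ e → 0ℚ ≤ y e) → (∀ e → y e ≤ x e) → energy x ≤ energy y → ∀ e → x e ≡ y e
  energy-squeeze x y 0≤y y≤x Ex≤Ey e = p-q≡0⇒p≡q (p*p≤0⇒p≡0 (x e - y e) (≤-reflexive (gap≡0 e)))
    where
    gap : Vect _
    gap e = (x e - y e) * (x e - y e)
    gap≤ : ∀ e → gap e ≤ x e * x e - y e * y e
    gap≤ e = ≤-by-difference (*-nonNeg (+-nonNeg (0≤y e) (0≤y e)) (p≤q⇒0≤q-p (y≤x e)))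
      (solve 2 (λ x y → (y :+ y) :* (x :- y) :- con 0ℚ := (x :* x :- y :* y) :- (x :- y) :* (x :- y)) refl (x e) (y e))
    Σgap≤0 : Σ[ gap ] ≤ 0ℚ
    Σgap≤0 = ≤-trans (Σ-mono-≤ gap≤) (subst (_≤ 0ℚ) (sym (Σ-sub (λ e → x e * x e) (λ e → y e * y e)))
      (≤-by-difference Ex≤Ey (solve 2 (λ a b → b :- a := con 0ℚ :- (a :- b)) refl (energy x) (energy y))))
    gap≡0 : ∀ e → gap e ≡ 0ℚ
    gap≡0 = Σ-nonNeg≤0⇒≡0 (λ e → 0≤p*p (x e - y e)) Σgap≤0

  -- The midpoint of two admissible densities is admissible, and its energy falls short of the
  -- average energy by ¼ Σ (a - b)²; so a second density of no larger energy must coincide.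
  optimal-unique : {Γ : Family n} (a b : Vect n) → OptimalDensity Γ a → Adm Γ b → energy b ≤ energy a → ∀ e → a e ≡ b e
  optimal-unique {n} {Γ} a b ((0≤a , adm-a) , optimal) (0≤b , adm-b) Eb≤Ea e =
    p-q≡0⇒p≡q (p*p≤0⇒p≡0 (a e - b e) (≤-reflexive (gap≡0 e)))
    where
    mid : Vect n
    mid e = ½ * (a e + b e)
    0≤½ : 0ℚ ≤ ½
    0≤½ = <⇒≤ (positive⁻¹ ½)
    mid-admissible : Adm Γ mid
    mid-admissible = (λ e → *-nonNeg 0≤½ (+-nonNeg (0≤a e) (0≤b e))) , λ γ γ∈Γ →
      subst (1ℚ ≤_) (sym (trans (dot-*ʳ ½ γ (λ e → a e + b e)) (cong (½ *_) (dot-+ʳ γ a b))))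
        (subst (_≤ ½ * (dot γ a + dot γ b)) refl (*-monoˡ-≤-0≤ ½ 0≤½ (+-mono-≤ (adm-a γ γ∈Γ) (adm-b γ γ∈Γ))))
    gap : Vect n
    gap e = (a e - b e) * (a e - b e)
    E-mid : energy mid ≡ ½ * energy a + ½ * energy b - ½ * ½ * Σ[ gap ]
    E-mid = trans (Σ-cong (λ e → solve 2 (λ a b → (con ½ :* (a :+ b)) :* (con ½ :* (a :+ b))
                   := con ½ :* (a :* a) :+ con ½ :* (b :* b) :- con ½ :* con ½ :* ((a :- b) :* (a :- b))) refl (a e) (b e)))
      (trans (Σ-sub (λ e → ½ * (a e * a e) + ½ * (b e * b e)) (λ e → ½ * ½ * gap e))
        (cong₂ _-_ (trans (Σ-+ (λ e → ½ * (a e * a e)) (λ e → ½ * (b e * b e)))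
                          (cong₂ _+_ (Σ-* ½ (λ e → a e * a e)) (Σ-* ½ (λ e → b e * b e))))
                   (Σ-* (½ * ½) gap)))
    ¼Σgap≤0 : ½ * ½ * Σ[ gap ] ≤ 0ℚ
    ¼Σgap≤0 = ≤-by-difference (+-nonNeg (p≤q⇒0≤q-p (subst (energy a ≤_) E-mid (optimal mid mid-admissible)))
                                         (*-nonNeg 0≤½ (p≤q⇒0≤q-p Eb≤Ea)))
      (solve 3 (λ Ea Eb G → ((con ½ :* Ea :+ con ½ :* Eb :- con ½ :* con ½ :* G) :- Ea) :+ con ½ :* (Ea :- Eb) :- con 0ℚ
                            := con 0ℚ :- con ½ :* con ½ :* G) refl (energy a) (energy b) (Σ[ gap ]))
    gap≡0 : ∀ e → gap e ≡ 0ℚ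
    gap≡0 = Σ-nonNeg≤0⇒≡0 (λ e → 0≤p*p (a e - b e))
      (*-cancelˡ-≤-pos (½ * ½) {{positive (*-pos (positive⁻¹ ½) (positive⁻¹ ½))}}
        (subst (½ * ½ * Σ[ gap ] ≤_) (sym (*-zeroʳ (½ * ½))) ¼Σgap≤0))

module SubsetFacts where

  open import Data.Nat using (ℕ; zero; suc)
  open import Data.Fin using (Fin; zero; suc)
  open import Data.Fin.Subset
  open import Data.Fin.Subset.Properties
  open import Data.Vec using (_∷_; here; there)
  open import Data.Empty using (⊥-elim)
  open import Function using (_∘_)
  open import Relation.Binary.PropositionalEquality
  import Algebra.Lattice.Properties.BooleanAlgebra as BooleanAlgebra

  private
    variable
      n : ℕ
      x : Fin n
      p q : Subset n

  ∁-involutive : (p : Subset n) → ∁ (∁ p) ≡ p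
  ∁-involutive {n} = BooleanAlgebra.¬-involutive (∪-∩-booleanAlgebra n)

  x∈p⇒∣p∣≡1+∣p-x∣ : x ∈ p → ∣ p ∣ ≡ suc ∣ p - x ∣
  x∈p⇒∣p∣≡1+∣p-x∣ {p = inside ∷ p} here = cong (suc ∘ ∣_∣) (sym (p─⊥≡p p))
  x∈p⇒∣p∣≡1+∣p-x∣ {p = inside ∷ p} (there x∈p) = cong suc (x∈p⇒∣p∣≡1+∣p-x∣ x∈p)
  x∈p⇒∣p∣≡1+∣p-x∣ {p = outside ∷ p} (there x∈p) = x∈p⇒∣p∣≡1+∣p-x∣ x∈p

  x∉p⇒∣p∪⁅x⁆∣≡1+∣p∣ : x ∉ p → ∣ p ∪ ⁅ x ⁆ ∣ ≡ suc ∣ p ∣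
  x∉p⇒∣p∪⁅x⁆∣≡1+∣p∣ {x = zero} {p = inside ∷ p} x∉p = ⊥-elim (x∉p here)
  x∉p⇒∣p∪⁅x⁆∣≡1+∣p∣ {x = zero} {p = outside ∷ p} x∉p = cong (suc ∘ ∣_∣) (∪-identityʳ p)
  x∉p⇒∣p∪⁅x⁆∣≡1+∣p∣ {x = suc x} {p = inside ∷ p} x∉p = cong suc (x∉p⇒∣p∪⁅x⁆∣≡1+∣p∣ (x∉p ∘ there))
  x∉p⇒∣p∪⁅x⁆∣≡1+∣p∣ {x = suc x} {p = outside ∷ p} x∉p = x∉p⇒∣p∪⁅x⁆∣≡1+∣p∣ (x∉p ∘ there)

  x∈p─q⇒x∉q : x ∈ p ─ q → x ∉ q
  x∈p─q⇒x∉q {p = s ∷ p} {q = inside ∷ q} (there x∈) (there x∈q) = x∈p─q⇒x∉q x∈ x∈q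
  x∈p─q⇒x∉q {p = inside ∷ p} {q = outside ∷ q} (there x∈) (there x∈q) = x∈p─q⇒x∉q x∈ x∈q
  x∈p─q⇒x∉q {p = outside ∷ p} {q = outside ∷ q} (there x∈) (there x∈q) = x∈p─q⇒x∉q x∈ x∈q

module SubsetEnumeration where

  open import Data.Nat using (ℕ; zero; suc)
  open import Data.Fin using (Fin)
  open import Data.Fin.Subset using (Subset; inside; outside)
  open import Data.Vec using ([]; _∷_)
  open import Data.List using (List; [_]; _++_; map; filter; length; lookup)
  open import Data.List.Membership.Propositional using (_∈_)
  open import Data.List.Membership.Propositional.Properties using (∈-map⁺; ∈-++⁺ˡ; ∈-++⁺ʳ; ∈-filter⁺; ∈-filter⁻; ∈-lookup)
  open import Data.List.Relation.Unary.Any using (here; index)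
  open import Data.List.Relation.Unary.Any.Properties using (lookup-index)
  open import Data.Product using (Σ; _,_; proj₂)
  open import Relation.Binary.PropositionalEquality using (_≡_; refl; sym)
  open import Relation.Nullary using (¬_; Dec)
  open import Relation.Nullary.Decidable using (¬¬-excluded-middle)

  private
    variable
      n : ℕ

  allSubsets : ∀ n → List (Subset n)
  allSubsets zero    = [ [] ]
  allSubsets (suc n) = map (inside ∷_) (allSubsets n) ++ map (outside ∷_) (allSubsets n)

  ∈-allSubsets : (X : Subset n) → X ∈ allSubsets n
  ∈-allSubsets []            = here refl
  ∈-allSubsets (inside ∷ X)  = ∈-++⁺ˡ (∈-map⁺ (inside ∷_) (∈-allSubsets X))
  ∈-allSubsets {suc n} (outside ∷ X) = ∈-++⁺ʳ (map (inside ∷_) (allSubsets n)) (∈-map⁺ (outside ∷_) (∈-allSubsets X))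

  record Listing (P : Subset n → Set) : Set where
    field
      size     : ℕ
      element  : Fin size → Subset n
      sound    : ∀ i → P (element i)
      complete : ∀ {X} → P X → Σ (Fin size) λ i → element i ≡ X

  listing : {P : Subset n → Set} → (∀ X → Dec (P X)) → Listing P
  listing {n} P? = record
    { size = length members ; element = lookup members
    ; sound = λ i → proj₂ (∈-filter⁻ P? {xs = allSubsets n} (∈-lookup {xs = members} i))
    ; complete = λ {X} PX → let X∈ = ∈-filter⁺ P? (∈-allSubsets X) PX in index X∈ , sym (lookup-index X∈) }
    where members = filter P? (allSubsets n)

  ¬¬-decidable : (P : Subset n → Set) → ¬ ¬ (∀ X → Dec (P X))
  ¬¬-decidable {zero}  P k = ¬¬-excluded-middle λ P[]? → k λ { [] → P[]? }
  ¬¬-decidable {suc n} P k =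
    ¬¬-decidable (λ X → P (inside ∷ X)) λ P-in? →
    ¬¬-decidable (λ X → P (outside ∷ X)) λ P-out? →
    k λ { (inside ∷ X) → P-in? X ; (outside ∷ X) → P-out? X }

module NatRatios where

  open import Defs using (recip; _÷ℕ_)
  open RationalFacts
  open import Data.Nat as ℕ using (ℕ; zero; suc)
  import Data.Nat.Properties as ℕ
  open import Data.Integer as ℤ using () renaming (+_ to +ℤ)
  import Data.Integer.Properties as ℤ
  open import Data.Rational
  open import Data.Rational.Properties
  import Data.Rational.Unnormalised as ℚᵘ
  import Data.Rational.Unnormalised.Properties as ℚᵘ
  open import Data.Rational.Solver
  open import Relation.Binary.PropositionalEquality
  open import Relation.Nullary using (¬_; yes; no)
  open import Data.Empty using (⊥-elim)
  open +-*-Solver using (solve; _:=_; _:+_; _:*_; con)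

  toℚ : ℕ → ℚ
  toℚ zero    = 0ℚ
  toℚ (suc k) = 1ℚ + toℚ k

  toℚ-+ : ∀ m n → toℚ (m ℕ.+ n) ≡ toℚ m + toℚ n
  toℚ-+ zero    n = sym (+-identityˡ (toℚ n))
  toℚ-+ (suc m) n = trans (cong (1ℚ +_) (toℚ-+ m n)) (sym (+-assoc 1ℚ (toℚ m) (toℚ n)))

  toℚ-* : ∀ m n → toℚ (m ℕ.* n) ≡ toℚ m * toℚ n
  toℚ-* zero    n = sym (*-zeroˡ (toℚ n))
  toℚ-* (suc m) n = trans (toℚ-+ n (m ℕ.* n)) (trans (cong (toℚ n +_) (toℚ-* m n))
    (solve 2 (λ a b → b :+ a :* b := (con 1ℚ :+ a) :* b) refl (toℚ m) (toℚ n)))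

  0≤toℚ : ∀ k → 0ℚ ≤ toℚ k
  0≤toℚ zero    = ≤-refl
  0≤toℚ (suc k) = +-nonNeg 0≤1 (0≤toℚ k)

  0<toℚ : ∀ {k} → 0 ℕ.< k → 0ℚ < toℚ k
  0<toℚ {suc k} _ = +-mono-<-≤ (positive⁻¹ 1ℚ) (0≤toℚ k)

  toℚ≢0 : ∀ {k} → 0 ℕ.< k → ¬ toℚ k ≡ 0ℚ
  toℚ≢0 0<k = pos⇒≢0 (0<toℚ 0<k)

  toℚ-mono-≤ : ∀ {m n} → m ℕ.≤ n → toℚ m ≤ toℚ n
  toℚ-mono-≤ {m} {n} m≤n = subst₂ _≤_ (+-identityʳ (toℚ m))
    (trans (sym (toℚ-+ m (n ℕ.∸ m))) (cong toℚ (ℕ.m+[n∸m]≡n m≤n)))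
    (+-monoʳ-≤ (toℚ m) (0≤toℚ (n ℕ.∸ m)))

  toℚ-cancel-≤ : ∀ {m n} → toℚ m ≤ toℚ n → m ℕ.≤ n
  toℚ-cancel-≤ {m} {n} toℚm≤toℚn with m ℕ.≤? n
  ... | yes m≤n = m≤n
  ... | no m≰n = ⊥-elim (<-irrefl refl (<-≤-trans n<1+n (≤-trans (toℚ-mono-≤ (ℕ.≰⇒> m≰n)) toℚm≤toℚn)))
    where
    n<1+n : toℚ n < toℚ (suc n)
    n<1+n = subst (_< 1ℚ + toℚ n) (+-identityˡ (toℚ n)) (+-monoˡ-< (toℚ n) (positive⁻¹ 1ℚ))

  toℚᵘ-toℚ : ∀ k → toℚᵘ (toℚ k) ℚᵘ.≃ ℚᵘ.mkℚᵘ (+ℤ k) 0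
  toℚᵘ-toℚ zero    = ℚᵘ.≃-refl
  toℚᵘ-toℚ (suc k) = ℚᵘ.≃-trans (toℚᵘ-homo-+ 1ℚ (toℚ k))
    (ℚᵘ.≃-trans (ℚᵘ.+-cong (ℚᵘ.≃-refl {toℚᵘ 1ℚ}) (toℚᵘ-toℚ k)) (ℚᵘ.*≡* eq))
    where
    eq : (+ℤ 1 ℤ.* +ℤ 1 ℤ.+ +ℤ k ℤ.* +ℤ 1) ℤ.* +ℤ 1 ≡ +ℤ (suc k) ℤ.* +ℤ 1
    eq = cong (ℤ._* +ℤ 1) (trans (cong (λ z → +ℤ 1 ℤ.+ z) (ℤ.*-identityʳ (+ℤ k))) (sym (ℤ.pos-+ 1 k)))

  ÷ℕ-*-cancel : ∀ a b → (a ÷ℕ suc b) * toℚ (suc b) ≡ toℚ a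
  ÷ℕ-*-cancel a b = toℚᵘ-injective (ℚᵘ.≃-trans (toℚᵘ-homo-* (a ÷ℕ suc b) (toℚ (suc b)))
    (ℚᵘ.≃-trans (ℚᵘ.*-cong (toℚᵘ-fromℚᵘ (ℚᵘ.mkℚᵘ (+ℤ a) b)) (toℚᵘ-toℚ (suc b)))
      (ℚᵘ.≃-trans (ℚᵘ.*≡* eq) (ℚᵘ.≃-sym (toℚᵘ-toℚ a)))))
    where
    eq : (+ℤ a ℤ.* +ℤ (suc b)) ℤ.* +ℤ 1 ≡ +ℤ a ℤ.* +ℤ (suc (b ℕ.* 1))
    eq = trans (ℤ.*-identityʳ (+ℤ a ℤ.* +ℤ (suc b))) (cong (λ c → +ℤ a ℤ.* +ℤ (suc c)) (sym (ℕ.*-identityʳ b)))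

  ÷ℕ-toℚ : ∀ a {b} → 0 ℕ.< b → a ÷ℕ b ≡ toℚ a * recip (toℚ b)
  ÷ℕ-toℚ a {suc b} 0<b = begin
    a ÷ℕ suc b                                  ≡⟨ *-identityʳ (a ÷ℕ suc b) ⟨
    a ÷ℕ suc b * 1ℚ                             ≡⟨ cong (a ÷ℕ suc b *_) (*-recipʳ (toℚ (suc b)) (toℚ≢0 0<b)) ⟨
    a ÷ℕ suc b * (toℚ (suc b) * recip (toℚ (suc b))) ≡⟨ *-assoc (a ÷ℕ suc b) _ _ ⟨
    a ÷ℕ suc b * toℚ (suc b) * recip (toℚ (suc b))   ≡⟨ cong (_* recip (toℚ (suc b))) (÷ℕ-*-cancel a b) ⟩
    toℚ a * recip (toℚ (suc b))                 ∎
    where open ≡-Reasoning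

  ÷ℕ-self : ∀ {a} → 0 ℕ.< a → a ÷ℕ a ≡ 1ℚ
  ÷ℕ-self {a} 0<a = trans (÷ℕ-toℚ a 0<a) (*-recipʳ (toℚ a) (toℚ≢0 0<a))

  ÷ℕ-+ : ∀ a b {c} → 0 ℕ.< c → a ÷ℕ c + b ÷ℕ c ≡ (a ℕ.+ b) ÷ℕ c
  ÷ℕ-+ a b {c} 0<c = begin
    a ÷ℕ c + b ÷ℕ c                               ≡⟨ cong₂ _+_ (÷ℕ-toℚ a 0<c) (÷ℕ-toℚ b 0<c) ⟩
    toℚ a * recip (toℚ c) + toℚ b * recip (toℚ c) ≡⟨ *-distribʳ-+ (recip (toℚ c)) (toℚ a) (toℚ b) ⟨
    (toℚ a + toℚ b) * recip (toℚ c)               ≡⟨ cong (_* recip (toℚ c)) (toℚ-+ a b) ⟨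
    toℚ (a ℕ.+ b) * recip (toℚ c)                 ≡⟨ ÷ℕ-toℚ (a ℕ.+ b) 0<c ⟨
    (a ℕ.+ b) ÷ℕ c                                ∎
    where open ≡-Reasoning

  ÷ℕ-cross : ∀ a {b} c {d} → 0 ℕ.< b → 0 ℕ.< d → a ℕ.* d ≡ c ℕ.* b → a ÷ℕ b ≡ c ÷ℕ d
  ÷ℕ-cross a {b} c {d} 0<b 0<d ad≡cb = begin
    a ÷ℕ b              ≡⟨ ÷ℕ-toℚ a 0<b ⟩
    A * rB              ≡⟨ trans (cong (A * rB *_) (*-recipʳ D (toℚ≢0 0<d))) (*-identityʳ (A * rB)) ⟨
    A * rB * (D * rD)   ≡⟨ solve 4 (λ A rB D rD → A :* rB :* (D :* rD) := A :* D :* rB :* rD) refl A rB D rD ⟩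
    A * D * rB * rD     ≡⟨ cong (λ x → x * rB * rD) AD≡CB ⟩
    C * B * rB * rD     ≡⟨ solve 4 (λ C B rB rD → C :* B :* rB :* rD := C :* rD :* (B :* rB)) refl C B rB rD ⟩
    C * rD * (B * rB)   ≡⟨ trans (cong (C * rD *_) (*-recipʳ B (toℚ≢0 0<b))) (*-identityʳ (C * rD)) ⟩
    C * rD              ≡⟨ ÷ℕ-toℚ c 0<d ⟨
    c ÷ℕ d              ∎
    where
    open ≡-Reasoning
    A = toℚ a ; B = toℚ b ; C = toℚ c ; D = toℚ d
    rB = recip B ; rD = recip D
    AD≡CB : A * D ≡ C * B
    AD≡CB = trans (sym (toℚ-* a d)) (trans (cong toℚ ad≡cb) (toℚ-* c b))

  recip-÷ℕ : ∀ {a b} → 0 ℕ.< a → 0 ℕ.< b → recip (a ÷ℕ b) ≡ b ÷ℕ a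
  recip-÷ℕ {a} {b} 0<a 0<b = recip-unique (a ÷ℕ b) (b ÷ℕ a) (begin
    a ÷ℕ b * b ÷ℕ a                   ≡⟨ cong₂ _*_ (÷ℕ-toℚ a 0<b) (÷ℕ-toℚ b 0<a) ⟩
    A * recip B * (B * recip A)       ≡⟨ solve 4 (λ A rB B rA → A :* rB :* (B :* rA) := (A :* rA) :* (B :* rB))
                                           refl A (recip B) B (recip A) ⟩
    A * recip A * (B * recip B)       ≡⟨ cong₂ _*_ (*-recipʳ A (toℚ≢0 0<a)) (*-recipʳ B (toℚ≢0 0<b)) ⟩
    1ℚ * 1ℚ                           ≡⟨⟩
    1ℚ                                ∎)
    where
    open ≡-Reasoning
    A = toℚ a ; B = toℚ b

  ÷ℕ-≤⇒*-≤ : ∀ a {b} c {d} → 0 ℕ.< b → 0 ℕ.< d → a ÷ℕ b ≤ c ÷ℕ d → a ℕ.* d ℕ.≤ c ℕ.* b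
  ÷ℕ-≤⇒*-≤ a {b} c {d} 0<b 0<d a/b≤c/d = toℚ-cancel-≤ (subst₂ _≤_ (trans clearˡ (sym (toℚ-* a d)))
    (trans clearʳ (sym (toℚ-* c b))) (*-monoʳ-≤-0≤ (B * D) (*-nonNeg (0≤toℚ b) (0≤toℚ d))
      (subst₂ _≤_ (÷ℕ-toℚ a 0<b) (÷ℕ-toℚ c 0<d) a/b≤c/d)))
    where
    A = toℚ a ; B = toℚ b ; C = toℚ c ; D = toℚ d
    clearˡ : A * recip B * (B * D) ≡ A * D
    clearˡ = trans (solve 4 (λ A rB B D → A :* rB :* (B :* D) := A :* D :* (B :* rB)) refl A (recip B) B D)
      (trans (cong (A * D *_) (*-recipʳ B (toℚ≢0 0<b))) (*-identityʳ (A * D)))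
    clearʳ : C * recip D * (B * D) ≡ C * B
    clearʳ = trans (solve 4 (λ C rD B D → C :* rD :* (B :* D) := C :* B :* (D :* rD)) refl C (recip D) B D)
      (trans (cong (C * B *_) (*-recipʳ D (toℚ≢0 0<d))) (*-identityʳ (C * B)))

  *-complements-≤⇒≡ : ∀ {x₀ k₀ j₀ x₁ ρ₁ j₁} → k₀ ℕ.+ j₀ ≡ x₀ → ρ₁ ℕ.+ j₁ ≡ x₁ →
    x₁ ℕ.* k₀ ℕ.≤ x₀ ℕ.* ρ₁ → x₁ ℕ.* j₀ ℕ.≤ x₀ ℕ.* j₁ → x₁ ℕ.* k₀ ≡ x₀ ℕ.* ρ₁
  *-complements-≤⇒≡ {x₀} {k₀} {j₀} {x₁} {ρ₁} {j₁} refl refl x₁k₀≤x₀ρ₁ x₁j₀≤x₀j₁ =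
    ℕ.≤-antisym x₁k₀≤x₀ρ₁ (ℕ.+-cancelʳ-≤ (x₀ ℕ.* j₁) _ _ (begin
      x₀ ℕ.* ρ₁ ℕ.+ x₀ ℕ.* j₁ ≡⟨ ℕ.*-distribˡ-+ x₀ ρ₁ j₁ ⟨
      x₀ ℕ.* x₁               ≡⟨ ℕ.*-comm x₀ x₁ ⟩
      x₁ ℕ.* x₀               ≡⟨ ℕ.*-distribˡ-+ x₁ k₀ j₀ ⟩
      x₁ ℕ.* k₀ ℕ.+ x₁ ℕ.* j₀ ≤⟨ ℕ.+-monoʳ-≤ (x₁ ℕ.* k₀) x₁j₀≤x₀j₁ ⟩
      x₁ ℕ.* k₀ ℕ.+ x₀ ℕ.* j₁ ∎))
    where open ℕ.≤-Reasoning

  -- The two comparisons force k₀/x₀ = ρ₁/x₁.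
  complementary-reciprocals : ∀ {x₀ k₀ j₀ x₁ ρ₁ j₁} → 0 ℕ.< k₀ → 0 ℕ.< j₀ → 0 ℕ.< ρ₁ → 0 ℕ.< j₁ →
    k₀ ℕ.+ j₀ ≡ x₀ → ρ₁ ℕ.+ j₁ ≡ x₁ → x₁ ÷ℕ ρ₁ ≤ x₀ ÷ℕ k₀ → x₁ ÷ℕ j₁ ≤ x₀ ÷ℕ j₀ →
    recip (x₀ ÷ℕ k₀) + recip (x₁ ÷ℕ j₁) ≡ 1ℚ
  complementary-reciprocals {x₀} {k₀} {j₀} {x₁} {ρ₁} {j₁} 0<k₀ 0<j₀ 0<ρ₁ 0<j₁ refl refl ρ-ratio j-ratio = begin
    recip (x₀ ÷ℕ k₀) + recip (x₁ ÷ℕ j₁) ≡⟨ cong₂ _+_ (recip-÷ℕ 0<x₀ 0<k₀) (recip-÷ℕ 0<x₁ 0<j₁) ⟩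
    k₀ ÷ℕ x₀ + j₁ ÷ℕ x₁                 ≡⟨ cong (_+ j₁ ÷ℕ x₁) (÷ℕ-cross k₀ ρ₁ 0<x₀ 0<x₁ cross) ⟩
    ρ₁ ÷ℕ x₁ + j₁ ÷ℕ x₁                 ≡⟨ ÷ℕ-+ ρ₁ j₁ 0<x₁ ⟩
    x₁ ÷ℕ x₁                            ≡⟨ ÷ℕ-self 0<x₁ ⟩
    1ℚ                                  ∎
    where
    open ≡-Reasoning
    0<x₀ : 0 ℕ.< x₀
    0<x₀ = ℕ.<-≤-trans 0<k₀ (ℕ.m≤m+n k₀ j₀)
    0<x₁ : 0 ℕ.< x₁
    0<x₁ = ℕ.<-≤-trans 0<ρ₁ (ℕ.m≤m+n ρ₁ j₁)
    x₁k₀≤x₀ρ₁ : x₁ ℕ.* k₀ ℕ.≤ x₀ ℕ.* ρ₁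
    x₁k₀≤x₀ρ₁ = ÷ℕ-≤⇒*-≤ x₁ x₀ 0<ρ₁ 0<k₀ ρ-ratio
    x₁j₀≤x₀j₁ : x₁ ℕ.* j₀ ℕ.≤ x₀ ℕ.* j₁
    x₁j₀≤x₀j₁ = ÷ℕ-≤⇒*-≤ x₁ x₀ 0<j₁ 0<j₀ j-ratio
    cross : k₀ ℕ.* x₁ ≡ ρ₁ ℕ.* x₀
    cross = trans (ℕ.*-comm k₀ x₁) (trans (*-complements-≤⇒≡ {k₀ = k₀} {j₀} {ρ₁ = ρ₁} {j₁} refl refl x₁k₀≤x₀ρ₁ x₁j₀≤x₀j₁)
      (ℕ.*-comm x₀ ρ₁))

module BaseHull where

  open import Defs
  open RationalFacts
  open FiniteSums
  open NatRatios using (toℚ)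
  open FourierMotzkin using (Constraint; Solution)
  open VertexBound using (Presentation; vertex-bound)
  open BlockerDuality using (dominated-combination)
  open Modulus using (energy-squeeze)
  open SubsetEnumeration using (Listing)
  open import Data.Nat using (ℕ)
  open import Data.Fin using (Fin)
  open import Data.Fin.Subset using (Subset; ∁; ∣_∣; inside; outside)
  open import Data.Bool using (true; false; not)
  open import Data.Vec using (lookup; _∷_; [])
  open import Data.Vec.Properties using (lookup-map)
  open import Data.Rational hiding (∣_∣)
  open import Data.Rational.Properties
  open import Data.Rational.Solver
  open import Data.List using (List; map; allFin; _++_)
  open import Data.List.Membership.Propositional using (_∈_)
  open import Data.List.Membership.Propositional.Properties using (∈-map⁺; ∈-map⁻; ∈-++⁺ˡ; ∈-++⁺ʳ; ∈-++⁻; ∈-allFin)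
  open import Data.Product using (Σ; _×_; _,_; proj₁; proj₂)
  open import Data.Sum using (inj₁; inj₂)
  open import Relation.Binary.PropositionalEquality
  open +-*-Solver using (solve; _:=_; _:*_; _:-_; con)

  private
    variable
      n : ℕ

  indicator-nonNeg : (X : Subset n) (e : Fin n) → 0ℚ ≤ indicator X e
  indicator-nonNeg X e with lookup X e
  ... | true  = 0≤1
  ... | false = ≤-refl

  indicator-∁ : (X : Subset n) (e : Fin n) → indicator (∁ X) e ≡ 1ℚ - indicator X e
  indicator-∁ X e rewrite lookup-map e not X with lookup X e
  ... | true  = refl
  ... | false = refl

  Σ-indicator : (X : Subset n) → Σ[ indicator X ] ≡ toℚ ∣ X ∣
  Σ-indicator []            = refl
  Σ-indicator (inside ∷ X)  = cong (1ℚ +_) (Σ-indicator X)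
  Σ-indicator (outside ∷ X) = trans (+-identityˡ _) (Σ-indicator X)

  record InHull (𝓑 : BaseFamily n) (q : Vect n) : Set where
    field
      size    : ℕ
      member  : Fin size → Subset n
      in-𝓑    : ∀ i → 𝓑 (member i)
      μ       : Fin size → ℚ
      0≤μ     : ∀ i → 0ℚ ≤ μ i
      Σμ≡1    : Σ[ μ ] ≡ 1ℚ
      q≡      : ∀ e → q e ≡ Σ[ (λ i → μ i * indicator (member i) e) ]

  module _ {𝓑 : BaseFamily n} {q : Vect n} (hull : InHull 𝓑 q) where

    open InHull hull

    dot-hull : ∀ w → dot w q ≡ Σ[ (λ i → μ i * dot (indicator (member i)) w) ]
    dot-hull w = trans (dot-cong {a = w} (λ _ → refl) q≡) (dot-combination w μ (λ i → indicator (member i)))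

    hull⇒admissible : Adm (blocker (baseVecs 𝓑)) q
    hull⇒admissible = 0≤q , above
      where
      0≤q : ∀ e → 0ℚ ≤ q e
      0≤q e = subst (0ℚ ≤_) (sym (q≡ e)) (Σ-nonNeg (λ i → *-nonNeg (0≤μ i) (indicator-nonNeg (member i) e)))
      above : ∀ γ → blocker (baseVecs 𝓑) γ → 1ℚ ≤ dot γ q
      above γ ((_ , admissible) , _) = subst₂ _≤_ (trans (Σ-cong (λ i → *-identityʳ (μ i))) Σμ≡1) (sym (dot-hull γ))
        (Σ-mono-≤ (λ i → *-monoˡ-≤-0≤ (μ i) (0≤μ i) (admissible _ (member i , in-𝓑 i , λ _ → refl))))

    Σ-hull : ∀ {c} → (∀ B → 𝓑 B → Σ[ indicator B ] ≡ c) → Σ[ q ] ≡ c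
    Σ-hull {c} Σ𝓑≡c = begin
      Σ[ q ]                                        ≡⟨ Σ-cong (λ e → *-identityˡ (q e)) ⟨
      dot (λ _ → 1ℚ) q                              ≡⟨ dot-hull (λ _ → 1ℚ) ⟩
      Σ[ (λ i → μ i * dot (indicator (member i)) (λ _ → 1ℚ)) ] ≡⟨ Σ-cong (λ i → cong (μ i *_) (member-size i)) ⟩
      Σ[ (λ i → μ i * c) ]                          ≡⟨ Σ-cong (λ i → *-comm (μ i) c) ⟩
      Σ[ (λ i → c * μ i) ]                          ≡⟨ Σ-* c μ ⟩
      c * Σ[ μ ]                                    ≡⟨ cong (c *_) Σμ≡1 ⟩
      c * 1ℚ                                        ≡⟨ *-identityʳ c ⟩
      c                                             ∎
      where
      open ≡-Reasoning
      member-size : ∀ i → dot (indicator (member i)) (λ _ → 1ℚ) ≡ c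
      member-size i = trans (Σ-cong (λ e → *-identityʳ (indicator (member i) e))) (Σ𝓑≡c _ (in-𝓑 i))

    hull-∁ : {𝓓 : BaseFamily n} → (∀ X → 𝓑 X → 𝓓 (∁ X)) → InHull 𝓓 (λ e → 1ℚ - q e)
    hull-∁ ∁𝓑⊆𝓓 = record
      { size = size ; member = λ i → ∁ (member i) ; in-𝓑 = λ i → ∁𝓑⊆𝓓 _ (in-𝓑 i)
      ; μ = μ ; 0≤μ = 0≤μ ; Σμ≡1 = Σμ≡1 ; q≡ = λ e → sym (Σ∁≡ e) }
      where
      Σ∁≡ : ∀ e → Σ[ (λ i → μ i * indicator (∁ (member i)) e) ] ≡ 1ℚ - q e
      Σ∁≡ e = begin
        Σ[ (λ i → μ i * indicator (∁ (member i)) e) ]              ≡⟨ Σ-cong (λ i → cong (μ i *_) (indicator-∁ (member i) e)) ⟩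
        Σ[ (λ i → μ i * (1ℚ - indicator (member i) e)) ]           ≡⟨ Σ-cong (λ i → distrib (μ i) _) ⟩
        Σ[ (λ i → μ i - μ i * indicator (member i) e) ]            ≡⟨ Σ-sub μ _ ⟩
        Σ[ μ ] - Σ[ (λ i → μ i * indicator (member i) e) ]         ≡⟨ cong₂ _-_ Σμ≡1 (sym (q≡ e)) ⟩
        1ℚ - q e                                                   ∎
        where
        open ≡-Reasoning
        distrib : ∀ m v → m * (1ℚ - v) ≡ m - m * v
        distrib = solve 2 (λ m v → m :* (con 1ℚ :- v) := m :- m :* v) refl

  module _ {𝓑 : BaseFamily n} (bases : Listing 𝓑) where

    open Listing bases

    listed-covers : ∀ {ρ} → (∀ i → 1ℚ ≤ dot (indicator (element i)) ρ) → ∀ γ → baseVecs 𝓑 γ → 1ℚ ≤ dot γ ρ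
    listed-covers covered γ (X , 𝓑X , γ≡) with complete 𝓑X
    ... | i , refl = subst (1ℚ ≤_) (dot-cong (λ e → sym (γ≡ e)) (λ _ → refl)) (covered i)

    sign-constraint : Fin n → Constraint n
    sign-constraint e = unit e , 0ℚ

    cover-constraint : Fin size → Constraint n
    cover-constraint i = indicator (element i) , 1ℚ

    admissible-presentation : Presentation (Adm (baseVecs 𝓑))
    admissible-presentation = record
      { constraints = signs ++ covers
      ; sound = sound′
      ; complete = λ sat → (λ e → subst (0ℚ ≤_) (dot-unitˡ e _) (sat (∈-++⁺ˡ (∈-map⁺ sign-constraint (∈-allFin e)))))
                         , listed-covers (λ i → sat (∈-++⁺ʳ signs (∈-map⁺ cover-constraint (∈-allFin i))))
      ; sign = λ e → ∈-++⁺ˡ (∈-map⁺ sign-constraint (∈-allFin e)) }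
      where
      signs covers : List (Constraint n)
      signs = map sign-constraint (allFin n)
      covers = map cover-constraint (allFin size)
      sound′ : ∀ {x} → Adm (baseVecs 𝓑) x → Solution (signs ++ covers) x
      sound′ {x} (0≤x , admissible) c∈ with ∈-++⁻ signs c∈
      ... | inj₁ c∈signs with ∈-map⁻ sign-constraint c∈signs
      ...   | e , _ , refl = subst (0ℚ ≤_) (sym (dot-unitˡ e x)) (0≤x e)
      sound′ {x} (0≤x , admissible) c∈ | inj₂ c∈covers with ∈-map⁻ cover-constraint c∈covers
      ...   | i , _ , refl = admissible _ (element i , sound i , λ _ → refl)

    optimal-in-hull : ∀ {η} → OptimalDensity (blocker (baseVecs 𝓑)) η → InHull 𝓑 η
    optimal-in-hull {η} ((0≤η , above-blocker) , optimal) = record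
      { size = size ; member = element ; in-𝓑 = sound ; μ = μ ; 0≤μ = 0≤μ ; Σμ≡1 = Σμ≡1
      ; q≡ = energy-squeeze η q 0≤q dominated (optimal q (hull⇒admissible q-in-hull)) }
      where
      above-admissible : ∀ ρ → Adm (baseVecs 𝓑) ρ → 1ℚ ≤ dot ρ η
      above-admissible = vertex-bound admissible-presentation η 0≤η 1ℚ above-blocker
      combination : Σ (Fin size → ℚ) λ μ → (∀ i → 0ℚ ≤ μ i) × Σ[ μ ] ≡ 1ℚ
                    × (∀ e → Σ[ (λ i → μ i * indicator (element i) e) ] ≤ η e)
      combination = dominated-combination (λ i → indicator (element i)) η (λ i → indicator-nonNeg (element i)) 0≤η
        (λ ρ 0≤ρ covered → above-admissible ρ (0≤ρ , listed-covers covered))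
      μ : Fin size → ℚ
      μ = proj₁ combination
      0≤μ : ∀ i → 0ℚ ≤ μ i
      0≤μ = proj₁ (proj₂ combination)
      Σμ≡1 : Σ[ μ ] ≡ 1ℚ
      Σμ≡1 = proj₁ (proj₂ (proj₂ combination))
      q : Vect n
      q e = Σ[ (λ i → μ i * indicator (element i) e) ]
      dominated : ∀ e → q e ≤ η e
      dominated = proj₂ (proj₂ (proj₂ combination))
      q-in-hull : InHull 𝓑 q
      q-in-hull = record { size = size ; member = element ; in-𝓑 = sound ; μ = μ ; 0≤μ = 0≤μ ; Σμ≡1 = Σμ≡1 ; q≡ = λ _ → refl }
      0≤q : ∀ e → 0ℚ ≤ q e
      0≤q e = Σ-nonNeg (λ i → *-nonNeg (0≤μ i) (indicator-nonNeg (element i) e))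

module Complementarity where

  open import Defs
  open FiniteSums
  open Modulus using (optimal-unique)
  open SubsetEnumeration using (listing)
  open BaseHull
  open import Data.Nat using (ℕ)
  open import Data.Fin.Subset using (∁)
  open SubsetFacts using (∁-involutive)
  open import Data.Rational
  open import Data.Rational.Properties
  open import Data.Rational.Solver
  open import Data.Product using (_,_; proj₂)
  open import Relation.Binary.PropositionalEquality
  open import Relation.Nullary using (Dec)
  open +-*-Solver using (solve; _:=_; _:+_; _:*_; _:-_; con)

  private
    variable
      n : ℕ

  energy-complement : (x : Vect n) → energy (λ e → 1ℚ - x e) ≡ Σ[_] {n} (λ _ → 1ℚ) - (Σ[ x ] + Σ[ x ]) + energy x
  energy-complement {n} x = begin
    energy (λ e → 1ℚ - x e)                                        ≡⟨ Σ-cong (λ e → expand (x e)) ⟩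
    Σ[ (λ e → (1ℚ - (x e + x e)) + x e * x e) ]                    ≡⟨ Σ-+ (λ e → 1ℚ - (x e + x e)) (λ e → x e * x e) ⟩
    Σ[ (λ e → 1ℚ - (x e + x e)) ] + energy x                       ≡⟨ cong (_+ energy x) (Σ-sub (λ _ → 1ℚ) (λ e → x e + x e)) ⟩
    Σ[_] {n} (λ _ → 1ℚ) - Σ[ (λ e → x e + x e) ] + energy x         ≡⟨ cong (λ s → Σ[_] {n} (λ _ → 1ℚ) - s + energy x) (Σ-+ x x) ⟩
    Σ[_] {n} (λ _ → 1ℚ) - (Σ[ x ] + Σ[ x ]) + energy x              ∎
    where
    open ≡-Reasoning
    expand : ∀ a → (1ℚ - a) * (1ℚ - a) ≡ (1ℚ - (a + a)) + a * a
    expand = solve 1 (λ a → (con 1ℚ :- a) :* (con 1ℚ :- a) := (con 1ℚ :- (a :+ a)) :+ a :* a) refl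

  -- Both optimal densities lie in the hulls of their families and complementation swaps the
  -- hulls. Hull points have total mass c, so E(1 - x) = E(x) + const there, and 1 - η does at
  -- least as well as η∘ for the dual problem.
  module _ {𝓑 : BaseFamily n} (𝓑? : ∀ X → Dec (𝓑 X)) {c : ℚ} (equisized : ∀ B → 𝓑 B → Σ[ indicator B ] ≡ c) where

    complementary-densities : ∀ {η η∘} → OptimalDensity (blocker (baseVecs 𝓑)) η →
      OptimalDensity (blocker (baseVecs (dualBases 𝓑))) η∘ → ∀ e → η∘ e ≡ 1ℚ - η e
    complementary-densities {η} {η∘} optη optη∘ =
      optimal-unique η∘ (λ e → 1ℚ - η e) optη∘ (hull⇒admissible (hull-∁ η-hull ∁-of-base)) E[1-η]≤E[η∘]
      where
      ∁-of-base : ∀ X → 𝓑 X → dualBases 𝓑 (∁ X)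
      ∁-of-base X = subst 𝓑 (sym (∁-involutive X))
      η-hull : InHull 𝓑 η
      η-hull = optimal-in-hull (listing 𝓑?) optη
      1-η∘-hull : InHull 𝓑 (λ e → 1ℚ - η∘ e)
      1-η∘-hull = hull-∁ (optimal-in-hull (listing (λ X → 𝓑? (∁ X))) optη∘) (λ _ 𝓑X → 𝓑X)
      K = Σ[_] {n} (λ _ → 1ℚ)
      Ση≡c : Σ[ η ] ≡ c
      Ση≡c = Σ-hull η-hull equisized
      Ση∘≡K-c : Σ[ η∘ ] ≡ K - c
      Ση∘≡K-c = trans (solve 2 (λ k s → s := k :- (k :- s)) refl K Σ[ η∘ ])
                      (cong (λ s → K - s) (trans (sym (Σ-sub (λ _ → 1ℚ) η∘)) (Σ-hull 1-η∘-hull equisized)))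
      E[1-η]≤E[η∘] : energy (λ e → 1ℚ - η e) ≤ energy η∘
      E[1-η]≤E[η∘] = subst₂ _≤_
        (sym (trans (energy-complement η) (cong (λ s → K - (s + s) + energy η) Ση≡c)))
        (trans (cong (K - (c + c) +_) (trans (energy-complement η∘) (cong (λ s → K - (s + s) + energy η∘) Ση∘≡K-c)))
               (solve 3 (λ k c x → k :- (c :+ c) :+ (k :- ((k :- c) :+ (k :- c)) :+ x) := x) refl K c (energy η∘)))
        (+-monoʳ-≤ (K - (c + c)) (proj₂ optη (λ e → 1ℚ - η∘ e) (hull⇒admissible 1-η∘-hull)))

module MatroidBases where

  open import Defs using (Matroid; IsBase; exchange; RankIs)
  open import Data.Nat as ℕ using (ℕ; _∸_)
  open import Data.Nat.Induction using (<-wellFounded)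
  import Data.Nat.Properties as ℕ
  open import Data.Fin using (Fin)
  open import Data.Fin.Subset
  open import Data.Fin.Subset.Properties
  open SubsetFacts
  open import Data.Product using (_,_)
  open import Data.Sum using (inj₁; inj₂)
  open import Data.Empty using (⊥-elim)
  open import Function using (_∘_)
  open import Induction.WellFounded using (module All)
  import Relation.Binary.Construct.On as On
  open import Relation.Binary.PropositionalEquality
  open import Relation.Nullary using (yes; no)

  private
    variable
      n : ℕ
      x y : Fin n

  module _ (M : Matroid n) where

    private
      𝓑 = IsBase M

    exchange-card : ∀ {B} → x ∈ B → y ∉ B → ∣ (B - x) ∪ ⁅ y ⁆ ∣ ≡ ∣ B ∣
    exchange-card x∈B y∉B =
      trans (x∉p⇒∣p∪⁅x⁆∣≡1+∣p∣ (y∉B ∘ p─q⊆p _ _)) (sym (x∈p⇒∣p∣≡1+∣p-x∣ x∈B))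

    exchange-shrinks : ∀ {B B₂} → x ∈ B ─ B₂ → y ∈ B₂ → ∣ ((B - x) ∪ ⁅ y ⁆) ─ B₂ ∣ ℕ.< ∣ B ─ B₂ ∣
    exchange-shrinks {x = x} {y = y} {B = B} {B₂ = B₂} x∈ y∈B₂ =
      ℕ.≤-<-trans (p⊆q⇒∣p∣≤∣q∣ shrunk) (x∈p⇒∣p-x∣<∣p∣ x∈)
      where
      shrunk : ((B - x) ∪ ⁅ y ⁆) ─ B₂ ⊆ (B ─ B₂) - x
      shrunk z∈ with x∈p∪q⁻ (B - x) ⁅ y ⁆ (p─q⊆p _ _ z∈)
      ... | inj₂ z∈⁅y⁆ rewrite x∈⁅y⁆⇒x≡y y z∈⁅y⁆ = ⊥-elim (x∈p─q⇒x∉q z∈ y∈B₂)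
      ... | inj₁ z∈B-x = x∈p∧x≢y⇒x∈p-y (x∈p∧x∉q⇒x∈p─q (p─q⊆p _ _ z∈B-x) (x∈p─q⇒x∉q z∈))
                                        (x∉⁅y⁆⇒x≢y (x∈p─q⇒x∉q z∈B-x))

    base-⊆ : ∀ {B₁ B₂} → 𝓑 B₁ → 𝓑 B₂ → B₁ ⊆ B₂ → B₂ ⊆ B₁
    base-⊆ {B₁} {B₂} 𝓑B₁ 𝓑B₂ B₁⊆B₂ {z} z∈B₂ with z ∈? B₁
    ... | yes z∈B₁ = z∈B₁
    ... | no z∉B₁ with exchange M B₂ B₁ 𝓑B₂ 𝓑B₁ z z∈B₂ z∉B₁
    ...   | y , y∈B₁ , y∉B₂ , _ = ⊥-elim (y∉B₂ (B₁⊆B₂ y∈B₁))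

    equicardinal : ∀ {B₁ B₂} → 𝓑 B₁ → 𝓑 B₂ → ∣ B₁ ∣ ≡ ∣ B₂ ∣
    equicardinal {B₁} {B₂} 𝓑B₁ 𝓑B₂ =
      All.wfRec (On.wellFounded (λ B → ∣ B ─ B₂ ∣) <-wellFounded) _ (λ B → 𝓑 B → ∣ B ∣ ≡ ∣ B₂ ∣) step B₁ 𝓑B₁
      where
      step : ∀ B → (∀ {B′} → ∣ B′ ─ B₂ ∣ ℕ.< ∣ B ─ B₂ ∣ → 𝓑 B′ → ∣ B′ ∣ ≡ ∣ B₂ ∣) → 𝓑 B → ∣ B ∣ ≡ ∣ B₂ ∣
      step B ih 𝓑B with nonempty? (B ─ B₂)
      ... | yes (x , x∈) with exchange M B B₂ 𝓑B 𝓑B₂ x (p─q⊆p _ _ x∈) (x∈p─q⇒x∉q x∈)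
      ...   | y , y∈B₂ , y∉B , 𝓑B′ = trans (sym (exchange-card (p─q⊆p _ _ x∈) y∉B)) (ih (exchange-shrinks x∈ y∈B₂) 𝓑B′)
      step B ih 𝓑B | no B─B₂-empty = ℕ.≤-antisym (p⊆q⇒∣p∣≤∣q∣ B⊆B₂) (p⊆q⇒∣p∣≤∣q∣ (base-⊆ 𝓑B 𝓑B₂ B⊆B₂))
        where
        B⊆B₂ : B ⊆ B₂
        B⊆B₂ {z} z∈B with z ∈? B₂
        ... | yes z∈B₂ = z∈B₂
        ... | no z∉B₂ = ⊥-elim (B─B₂-empty (z , x∈p∧x∉q⇒x∈p─q z∈B z∉B₂))

    base-card : ∀ {r} → RankIs 𝓑 ⊤ r → ∀ {B} → 𝓑 B → ∣ B ∣ ≡ r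
    base-card ((B₀ , 𝓑B₀ , ∣B₀∩⊤∣≡r) , _) 𝓑B = trans (equicardinal 𝓑B 𝓑B₀) (trans (cong ∣_∣ (sym (∩-identityʳ B₀))) ∣B₀∩⊤∣≡r)

    cobase-card : ∀ {r} → RankIs 𝓑 ⊤ r → ∀ {B} → 𝓑 (∁ B) → ∣ B ∣ ≡ n ∸ r
    cobase-card {r} rank {B} 𝓑∁B = begin
      ∣ B ∣           ≡⟨ cong ∣_∣ (∁-involutive B) ⟨
      ∣ ∁ (∁ B) ∣     ≡⟨ ∣∁p∣≡n∸∣p∣ (∁ B) ⟩
      n ∸ ∣ ∁ B ∣     ≡⟨ cong (n ∸_) (base-card rank 𝓑∁B) ⟩
      n ∸ r           ∎
      where open ≡-Reasoning

module DualRank where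

  open import Defs using (BaseFamily; RankIs; Loopless; IsFracArboricity; IsStrength; recip; _÷ℕ_)
  open NatRatios using (÷ℕ-≤⇒*-≤; complementary-reciprocals)
  open import Data.Nat as ℕ using (ℕ; suc; _+_; _*_; _∸_; _≤_; _<_; s≤s; z≤n)
  import Data.Nat.Properties as ℕ
  open import Data.Nat.Tactic.RingSolver using (solve-∀)
  open import Data.Fin.Subset
  open import Data.Fin.Subset.Properties
  open SubsetFacts using (∁-involutive; x∈p⇒∣p∣≡1+∣p-x∣)
  open import Data.Vec using ([]; _∷_)
  open import Data.Rational as ℚ using (ℚ; 1ℚ)
  open import Data.Product using (Σ; _×_; _,_)
  open import Relation.Binary.PropositionalEquality
  open import Relation.Nullary using (yes; no)
  open import Data.Empty using (⊥-elim)

  private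
    variable
      n : ℕ

  ∣∁p∩∁q∣+∣p∣+∣q∣≡n+∣p∩q∣ : (p q : Subset n) → ∣ ∁ p ∩ ∁ q ∣ + (∣ p ∣ + ∣ q ∣) ≡ n + ∣ p ∩ q ∣
  ∣∁p∩∁q∣+∣p∣+∣q∣≡n+∣p∩q∣ [] [] = refl
  ∣∁p∩∁q∣+∣p∣+∣q∣≡n+∣p∩q∣ {suc n} (inside ∷ p) (inside ∷ q) =
    trans (shift (∣ ∁ p ∩ ∁ q ∣) (∣ p ∣) (∣ q ∣)) (trans (cong (2 +_) (∣∁p∩∁q∣+∣p∣+∣q∣≡n+∣p∩q∣ p q)) (shift′ n (∣ p ∩ q ∣)))
    where
    shift : ∀ c a b → c + (suc a + suc b) ≡ 2 + (c + (a + b))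
    shift = solve-∀
    shift′ : ∀ n i → 2 + (n + i) ≡ suc n + suc i
    shift′ = solve-∀
  ∣∁p∩∁q∣+∣p∣+∣q∣≡n+∣p∩q∣ {suc n} (inside ∷ p) (outside ∷ q) =
    trans (ℕ.+-suc (∣ ∁ p ∩ ∁ q ∣) (∣ p ∣ + ∣ q ∣)) (cong suc (∣∁p∩∁q∣+∣p∣+∣q∣≡n+∣p∩q∣ p q))
  ∣∁p∩∁q∣+∣p∣+∣q∣≡n+∣p∩q∣ {suc n} (outside ∷ p) (inside ∷ q) =
    trans (cong (∣ ∁ p ∩ ∁ q ∣ +_) (ℕ.+-suc (∣ p ∣) (∣ q ∣)))
      (trans (ℕ.+-suc (∣ ∁ p ∩ ∁ q ∣) (∣ p ∣ + ∣ q ∣)) (cong suc (∣∁p∩∁q∣+∣p∣+∣q∣≡n+∣p∩q∣ p q)))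
  ∣∁p∩∁q∣+∣p∣+∣q∣≡n+∣p∩q∣ {suc n} (outside ∷ p) (outside ∷ q) = cong suc (∣∁p∩∁q∣+∣p∣+∣q∣≡n+∣p∩q∣ p q)

  module _ {𝓐 𝓒 : BaseFamily n} (𝓒⇒∁𝓐 : ∀ X → 𝓒 X → 𝓐 (∁ X)) (𝓐⇒∁𝓒 : ∀ X → 𝓐 X → 𝓒 (∁ X))
           {a : ℕ} (size : ∀ B → 𝓐 B → ∣ B ∣ ≡ a) where

    size-identity : ∀ {B} X → 𝓐 B → ∣ ∁ B ∩ ∁ X ∣ + (a + ∣ X ∣) ≡ n + ∣ B ∩ X ∣
    size-identity {B} X 𝓐B = subst (λ b → ∣ ∁ B ∩ ∁ X ∣ + (b + ∣ X ∣) ≡ n + ∣ B ∩ X ∣) (size B 𝓐B)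
      (∣∁p∩∁q∣+∣p∣+∣q∣≡n+∣p∩q∣ B X)

    -- r*(E ∖ X) = |E ∖ X| - r(E) + r(X), in the form r*(∁ X) + r(E) + |X| = n + r(X).
    dual-rank : ∀ {X k*} → RankIs 𝓒 (∁ X) k* → Σ ℕ λ k → RankIs 𝓐 X k × k* + (a + ∣ X ∣) ≡ n + k
    dual-rank {X} {k*} ((C₀ , 𝓒C₀ , ∣C₀∩∁X∣≡k*) , C₀-max) = ∣ ∁ C₀ ∩ X ∣ , ((∁ C₀ , 𝓒⇒∁𝓐 C₀ 𝓒C₀ , refl) , maximal) , identity
      where
      identity : k* + (a + ∣ X ∣) ≡ n + ∣ ∁ C₀ ∩ X ∣
      identity = trans (cong (λ c → c + (a + ∣ X ∣)) (trans (sym ∣C₀∩∁X∣≡k*) (cong (λ C → ∣ C ∩ ∁ X ∣) (sym (∁-involutive C₀)))))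
        (size-identity X (𝓒⇒∁𝓐 C₀ 𝓒C₀))
      maximal : ∀ B → 𝓐 B → ∣ B ∩ X ∣ ≤ ∣ ∁ C₀ ∩ X ∣
      maximal B 𝓐B = ℕ.+-cancelˡ-≤ n _ _ (subst₂ _≤_ (size-identity X 𝓐B) identity
        (ℕ.+-monoˡ-≤ (a + ∣ X ∣) (C₀-max (∁ B) (𝓐⇒∁𝓒 B 𝓐B))))

    dual-rank⁻ : ∀ {X k} → RankIs 𝓐 X k → Σ ℕ λ k* → RankIs 𝓒 (∁ X) k* × k* + (a + ∣ X ∣) ≡ n + k
    dual-rank⁻ {X} {k} ((B₀ , 𝓐B₀ , ∣B₀∩X∣≡k) , B₀-max) = ∣ ∁ B₀ ∩ ∁ X ∣ , ((∁ B₀ , 𝓐⇒∁𝓒 B₀ 𝓐B₀ , refl) , maximal) , identity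
      where
      identity : ∣ ∁ B₀ ∩ ∁ X ∣ + (a + ∣ X ∣) ≡ n + k
      identity = trans (size-identity X 𝓐B₀) (cong (n +_) ∣B₀∩X∣≡k)
      maximal : ∀ C → 𝓒 C → ∣ C ∩ ∁ X ∣ ≤ ∣ ∁ B₀ ∩ ∁ X ∣
      maximal C 𝓒C = ℕ.+-cancelʳ-≤ (a + ∣ X ∣) _ _ (subst₂ _≤_ (sym C-identity) (sym identity)
        (ℕ.+-monoʳ-≤ n (B₀-max (∁ C) (𝓒⇒∁𝓐 C 𝓒C))))
        where
        C-identity : ∣ C ∩ ∁ X ∣ + (a + ∣ X ∣) ≡ n + ∣ ∁ C ∩ X ∣
        C-identity = trans (cong (λ C′ → ∣ C′ ∩ ∁ X ∣ + (a + ∣ X ∣)) (sym (∁-involutive C))) (size-identity X (𝓒⇒∁𝓐 C 𝓒C))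

    dual-rank-⊤ : ∀ {k₁} → RankIs 𝓒 ⊤ k₁ → k₁ + a ≡ n
    dual-rank-⊤ {k₁} ((C₀ , 𝓒C₀ , ∣C₀∩⊤∣≡k₁) , _) = begin
      k₁ + a                  ≡⟨ cong₂ _+_ (trans (sym ∣C₀∩⊤∣≡k₁) (cong ∣_∣ (∩-identityʳ C₀))) (sym (size (∁ C₀) (𝓒⇒∁𝓐 C₀ 𝓒C₀))) ⟩
      ∣ C₀ ∣ + ∣ ∁ C₀ ∣       ≡⟨ cong (∣ C₀ ∣ +_) (∣∁p∣≡n∸∣p∣ C₀) ⟩
      ∣ C₀ ∣ + (n ∸ ∣ C₀ ∣)   ≡⟨ ℕ.m+[n∸m]≡n (∣p∣≤n C₀) ⟩
      n                       ∎
      where open ≡-Reasoning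

    private
      shift-rank : ∀ {k* k₁ k x} → k* + (a + x) ≡ n + k → k₁ + a ≡ n → k* + x ≡ k₁ + k
      shift-rank {k*} {k₁} {k} {x} identity k₁+a≡n = ℕ.+-cancelʳ-≡ a (k* + x) (k₁ + k) (begin
        k* + x + a        ≡⟨ swap k* x a ⟩
        k* + a + x        ≡⟨ ℕ.+-assoc k* a x ⟩
        k* + (a + x)      ≡⟨ identity ⟩
        n + k             ≡⟨ cong (_+ k) (sym k₁+a≡n) ⟩
        k₁ + a + k        ≡⟨ swap k₁ a k ⟩
        k₁ + k + a        ∎)
        where
        open ≡-Reasoning
        swap : ∀ p q r → p + q + r ≡ p + r + q
        swap = solve-∀

      nullity : ∀ {k* k₁ k x} → k* ≤ k₁ → k* + x ≡ k₁ + k → k + (k₁ ∸ k*) ≡ x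
      nullity {k*} {k₁} {k} {x} k*≤k₁ shifted = ℕ.+-cancelˡ-≡ k* _ x (begin
        k* + (k + (k₁ ∸ k*))  ≡⟨ ℕ.+-comm k* _ ⟩
        k + (k₁ ∸ k*) + k*    ≡⟨ ℕ.+-assoc k _ k* ⟩
        k + (k₁ ∸ k* + k*)    ≡⟨ cong (k +_) (ℕ.m∸n+n≡m k*≤k₁) ⟩
        k + k₁                ≡⟨ ℕ.+-comm k k₁ ⟩
        k₁ + k                ≡⟨ shifted ⟨
        k* + x                ∎)
        where open ≡-Reasoning

    -- The strength denominator r*(E) - r*(E ∖ X) of 𝓒 is the nullity |X| - r(X) in 𝓐.
    strength-denominator : ∀ {X k₁ k*} → RankIs 𝓒 ⊤ k₁ → RankIs 𝓒 (∁ X) k* → k* ≤ k₁ →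
                           Σ ℕ λ k → RankIs 𝓐 X k × k + (k₁ ∸ k*) ≡ ∣ X ∣
    strength-denominator {X} {k₁} {k*} rank-⊤ rank-∁X k*≤k₁ with dual-rank rank-∁X
    ... | k , rank-X , identity =
      k , rank-X , nullity k*≤k₁ (shift-rank {k*} {k₁} {k} {∣ X ∣} identity (dual-rank-⊤ rank-⊤))

    strength-denominator⁻ : ∀ {X k₁ k} → RankIs 𝓒 ⊤ k₁ → RankIs 𝓐 X k → k < ∣ X ∣ →
                            Σ ℕ λ k* → RankIs 𝓒 (∁ X) k* × k* < k₁ × k + (k₁ ∸ k*) ≡ ∣ X ∣
    strength-denominator⁻ {X} {k₁} {k} rank-⊤ rank-X k<∣X∣ with dual-rank⁻ rank-X
    ... | k* , rank-∁X , identity = k* , rank-∁X , k*<k₁ , nullity (ℕ.<⇒≤ k*<k₁) shifted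
      where
      shifted : k* + ∣ X ∣ ≡ k₁ + k
      shifted = shift-rank {k*} {k₁} {k} {∣ X ∣} identity (dual-rank-⊤ rank-⊤)
      k*<k₁ : k* < k₁
      k*<k₁ = ℕ.+-cancelʳ-< ∣ X ∣ k* k₁ (subst (_< k₁ + ∣ X ∣) (sym shifted) (ℕ.+-monoʳ-< k₁ k<∣X∣))

    rank-⊤ : ∀ {B} → 𝓐 B → RankIs 𝓐 ⊤ a
    rank-⊤ {B} 𝓐B = (B , 𝓐B , trans (cong ∣_∣ (∩-identityʳ B)) (size B 𝓐B))
                  , λ B′ 𝓐B′ → ℕ.≤-reflexive (trans (cong ∣_∣ (∩-identityʳ B′)) (size B′ 𝓐B′))

    loopless⇒0<rank : Loopless 𝓐 → ∀ {X k} → RankIs 𝓐 X k → 0 < ∣ X ∣ → 0 < k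
    loopless⇒0<rank loopless {X} (_ , maximal) 0<∣X∣ with nonempty? X
    ... | no X-empty = ⊥-elim (ℕ.<-irrefl (sym (trans (cong ∣_∣ (Empty-unique X-empty)) (∣⊥∣≡0 n))) 0<∣X∣)
    ... | yes (e , e∈X) with loopless e
    ...   | B , 𝓐B , ⁅e⁆⊆B = ℕ.<-≤-trans (subst (0 <_) (sym (x∈p⇒∣p∣≡1+∣p-x∣ (x∈p∩q⁺ (⁅e⁆⊆B (x∈⁅x⁆ e) , e∈X)))) (s≤s z≤n))
                                        (maximal B 𝓐B)

    -- Since r(E) < |E|, the densest set has |X| / r(X) ≥ |E| / r(E) > 1.
    arboricity-witness-nullity : 0 < a → a < n → ∀ {X₀ : Subset n} {k₀} → 0 < k₀ →
      (∀ X k → RankIs 𝓐 X k → 0 < k → ∣ X ∣ ÷ℕ k ℚ.≤ ∣ X₀ ∣ ÷ℕ k₀) → ∀ {B} → 𝓐 B → k₀ < ∣ X₀ ∣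
    arboricity-witness-nullity 0<a a<n {X₀} {k₀} 0<k₀ densest 𝓐B with k₀ ℕ.<? ∣ X₀ ∣
    ... | yes k₀<∣X₀∣ = k₀<∣X₀∣
    ... | no k₀≮∣X₀∣ = ⊥-elim (ℕ.<-irrefl refl (ℕ.≤-<-trans nk₀≤x₀a (ℕ.≤-<-trans (ℕ.*-monoˡ-≤ a (ℕ.≮⇒≥ k₀≮∣X₀∣)) k₀a<nk₀)))
      where
      nk₀≤x₀a : n * k₀ ≤ ∣ X₀ ∣ * a
      nk₀≤x₀a = ÷ℕ-≤⇒*-≤ n ∣ X₀ ∣ 0<a 0<k₀ (subst (λ m → m ÷ℕ a ℚ.≤ ∣ X₀ ∣ ÷ℕ k₀) (∣⊤∣≡n n) (densest (⊤ {n}) a (rank-⊤ 𝓐B) 0<a))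
      k₀a<nk₀ : k₀ * a < n * k₀
      k₀a<nk₀ = subst (k₀ * a <_) (ℕ.*-comm k₀ n) (ℕ.*-monoʳ-< k₀ {{ℕ.>-nonZero 0<k₀}} a<n)

    arboricity-strength-duality : Loopless 𝓐 → 0 < a → a < n → ∀ {B} → 𝓐 B → ∀ {d s} →
      IsFracArboricity 𝓐 d → IsStrength 𝓒 s → recip d ℚ.+ recip s ≡ 1ℚ
    arboricity-strength-duality loopless 0<a a<n 𝓐B
      ((X₀ , k₀ , rank-X₀ , 0<k₀ , refl) , densest) ((X₁ , k₁ , k* , rank-⊤ , rank-∁X₁ , k*<k₁ , refl) , weakest)
      with strength-denominator rank-⊤ rank-∁X₁ (ℕ.<⇒≤ k*<k₁)
         | strength-denominator⁻ rank-⊤ rank-X₀ (arboricity-witness-nullity 0<a a<n {X₀} 0<k₀ densest 𝓐B)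
    ... | ρ₁ , rank-X₁ , ρ₁+j₁≡x₁ | k*′ , rank-∁X₀ , k*′<k₁ , k₀+j₀≡x₀ =
      complementary-reciprocals 0<k₀ (ℕ.m<n⇒0<n∸m k*′<k₁) 0<ρ₁ 0<j₁ k₀+j₀≡x₀ ρ₁+j₁≡x₁
        (densest X₁ ρ₁ rank-X₁ 0<ρ₁) (weakest X₀ k₁ k*′ rank-⊤ rank-∁X₀ k*′<k₁)
      where
      0<j₁ : 0 < k₁ ∸ k*
      0<j₁ = ℕ.m<n⇒0<n∸m k*<k₁
      0<ρ₁ : 0 < ρ₁
      0<ρ₁ = loopless⇒0<rank loopless rank-X₁ (ℕ.<-≤-trans 0<j₁ (subst (k₁ ∸ k* ≤_) ρ₁+j₁≡x₁ (ℕ.m≤n+m _ ρ₁)))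

open NatRatios using (toℚ)
open RationalFacts using (p+[q-p]≡q)
open SubsetFacts using (∁-involutive)
open SubsetEnumeration using (¬¬-decidable)
open BaseHull using (Σ-indicator)
open Complementarity using (complementary-densities)
open MatroidBases using (base-card; cobase-card)
open DualRank using (arboricity-strength-duality)

open import Defs
open import Data.Nat using (ℕ; _<_)
import Data.Nat.Properties as ℕ
open import Data.Fin.Subset using (⊤; ∁)
open import Data.Rational using (ℚ; _+_; 1ℚ; _≟_)
open import Data.Rational.Properties using (+-comm)
open import Data.Product using (_×_; _,_; proj₁; proj₂)
open import Relation.Binary.PropositionalEquality using (_≡_; sym; trans; cong; subst)
open import Relation.Nullary.Decidable using (decidable-stable)

optimal-densities-complementary : ∀ {n} (M : Matroid n) {r} → RankIs (IsBase M) ⊤ r → ∀ {η η∘ : Vect n} →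
  OptimalDensity (blocker (baseVecs (IsBase M))) η → OptimalDensity (blocker (baseVecs (dualBases (IsBase M)))) η∘ →
  ∀ e → η e + η∘ e ≡ 1ℚ
optimal-densities-complementary M {r} rank {η} {η∘} optη optη∘ e =
  -- The goal is decidable, so we may assume that IsBase M is.
  decidable-stable (η e + η∘ e ≟ 1ℚ) λ ≢1 → ¬¬-decidable (IsBase M) λ IsBase? → ≢1
    (trans (cong (η e +_) (complementary-densities IsBase? equisized optη optη∘ e)) (p+[q-p]≡q (η e) 1ℚ))
  where
  equisized : ∀ B → IsBase M B → Σ[ indicator B ] ≡ toℚ r
  equisized B 𝓑B = trans (Σ-indicator B) (cong toℚ (base-card M rank 𝓑B))

arboricity-strength-dualities : ∀ {n} (M : Matroid n) → Loopless (IsBase M) → Loopless (dualBases (IsBase M)) →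
  ∀ {r} → RankIs (IsBase M) ⊤ r → 0 < r → r < n → ∀ {dM sM* sM dM*} →
  IsFracArboricity (IsBase M) dM → IsStrength (dualBases (IsBase M)) sM* →
  IsStrength (IsBase M) sM → IsFracArboricity (dualBases (IsBase M)) dM* →
  (recip dM + recip sM* ≡ 1ℚ) × (recip sM + recip dM* ≡ 1ℚ)
arboricity-strength-dualities M loopless loopless* rank 0<r r<n {sM = sM} {dM*} arbM strM* strM arbM* =
  arboricity-strength-duality (λ _ 𝓑*X → 𝓑*X) ∁-of-base (λ _ → base-card M rank) loopless 0<r r<n 𝓑B₀ arbM strM* ,
  trans (+-comm (recip sM) (recip dM*))
    (arboricity-strength-duality ∁-of-base (λ _ 𝓑*X → 𝓑*X) (λ _ → cobase-card M rank) loopless*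
       (ℕ.m<n⇒0<n∸m r<n) (ℕ.∸-monoʳ-< 0<r (ℕ.<⇒≤ r<n)) (∁-of-base _ 𝓑B₀) arbM* strM)
  where
  ∁-of-base : ∀ X → IsBase M X → dualBases (IsBase M) (∁ X)
  ∁-of-base X = subst (IsBase M) (sym (∁-involutive X))
  𝓑B₀ : IsBase M (proj₁ (base-exists M))
  𝓑B₀ = proj₂ (base-exists M)

corollary7p2 : ∀ {n} (M : Matroid n) → Loopless (IsBase M) →
    (r : ℕ) → RankIs (IsBase M) ⊤ r → 0 < r → r < n →
    (∀ (η η∘ : Vect n) →
       OptimalDensity (blocker (baseVecs (IsBase M))) η →
       OptimalDensity (blocker (baseVecs (dualBases (IsBase M)))) η∘ →
       ∀ e → η e + η∘ e ≡ 1ℚ)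
    × (Loopless (dualBases (IsBase M)) →
       ∀ (dM sM* sM dM* : ℚ) →
       IsFracArboricity (IsBase M) dM → IsStrength (dualBases (IsBase M)) sM* →
       IsStrength (IsBase M) sM → IsFracArboricity (dualBases (IsBase M)) dM* →
       (recip dM + recip sM* ≡ 1ℚ) × (recip sM + recip dM* ≡ 1ℚ))
corollary7p2 M loopless r rank 0<r r<n =
  (λ _ _ → optimal-densities-complementary M rank) ,
  (λ loopless* _ _ _ _ → arboricity-strength-dualities M loopless loopless* rank 0<r r<n)
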